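{- Let $n$, $a_1$, $a_2$ be positive integers and let $S=S(a_1,a_2)=\{x_1a_1+x_2a_2 : x_1,x_2\in\{0,1,2,\ldots\}\}$. Then the following three sets have the same cardinality: (i) the set of partitions of $n$ in which each part lies in $S$ and each difference $\lambda-\mu\ge 0$ between two parts $\lambda,\mu$ lies in $S$; (ii) the set of partitions of $n$ in which each part appears with multiplicity lying in $S$; (iii) the set of partitions of $n$ in which each part is divisible by $a_1$ or by $a_2$.
   Context: A partition of $n$ is an unordered multiset of positive integers (parts) whose sum is $n$. The multiplicity of a part is the number of times it occurs in the multiset. -}

module Defs where

open import Data.Nat using (ℕ; _+_; _*_; _∸_; _≤_; _≥_; _≟_)
open import Data.Nat.Divisibility using (_∣_)
open import Data.List using (List; length; filter)
open import Data.Nat.ListAction using (sum)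
open import Data.List.Relation.Unary.All using (All)
open import Data.List.Relation.Unary.Linked using (Linked)
open import Data.List.Membership.Propositional using (_∈_)
open import Data.Product using (∃₂; _×_)
open import Data.Sum using (_⊎_)
open import Relation.Binary.PropositionalEquality using (_≡_)

InS : ℕ → ℕ → ℕ → Set
InS a₁ a₂ m = ∃₂ λ x₁ x₂ → x₁ * a₁ + x₂ * a₂ ≡ m

mult : ℕ → List ℕ → ℕ
mult x xs = length (filter (x ≟_) xs)

-- A partition of n satisfying property P: a multiset of positive integers
-- summing to n, represented canonically as a non-increasing list.
-- All proof fields are irrelevant, so two such objects are equal iff
-- their lists of parts are equal (i.e. this is a subset, not a Σ-type
-- carrying proof data).
record PartitionWith (n : ℕ) (P : List ℕ → Set) : Set where
  constructor partition
  field
    parts    : List ℕ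
    .nonincr : Linked _≥_ parts
    .pos     : All (λ x → 1 ≤ x) parts
    .total   : sum parts ≡ n
    .prop    : P parts

CondI : ℕ → ℕ → List ℕ → Set
CondI a₁ a₂ ps =
  All (InS a₁ a₂) ps × (∀ {l m} → l ∈ ps → m ∈ ps → m ≤ l → InS a₁ a₂ (l ∸ m))

CondII : ℕ → ℕ → List ℕ → Set
CondII a₁ a₂ ps = ∀ {x} → x ∈ ps → InS a₁ a₂ (mult x ps)

CondIII : ℕ → ℕ → List ℕ → Set
CondIII a₁ a₂ ps = All (λ x → a₁ ∣ x ⊎ a₂ ∣ x) ps

module Submission where

-- A partition is handled through its multiplicity function k ↦ mult k: non-increasing lists
-- are determined by their multiplicities (sorted-ext, partition-ext), and a function f supported
-- on [1, n] with weight Σ k · f k = n is realised by the partition `expand f n`.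
--
-- (i) ↔ (ii) is conjugation.  The conjugate of λ₁ ≥ ⋯ ≥ λₙ (padded by zeros) has multiplicity
-- λₖ - λₖ₊₁ of k (`gaps`), and the conjugate of μ has parts Σ_{j ≥ k} mult j μ (`suffixSums`).
-- Since S is closed under addition, (i) says exactly that all gaps lie in S.
--
-- (ii) ↔ (iii) is a Glaisher-type bijection.  With b = a₁ / gcd(a₁, a₂), every v ∈ S is uniquely
-- a₁ X + a₂ Y with Y < b (`Canonical`); writing k = b ^ ν k · core k with b ∤ core k
-- (`Valuation`), a part k of multiplicity v becomes X parts k a₁ and Y · b ^ ν k parts
-- core k · a₂ (`spread`).  The inverse (`gather`) reads Y off as the (ν k)-th base-b digit of the
-- multiplicity of core k · a₂ (`Digits`).

open import Defs
open import Data.Nat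
open import Data.Nat.Properties
open import Data.Nat.DivMod
open import Data.Nat.Divisibility
open import Data.Nat.GCD using (gcd; gcd[m,n]∣m; gcd[m,n]∣n; gcd[m,n]≢0)
open import Data.Nat.Coprimality using (coprime-/gcd; coprime-divisor)
open import Data.Nat.ListAction using (sum)
open import Data.Nat.ListAction.Properties using (sum-++)
open import Data.List using (List; []; _∷_; _++_; length; filter; replicate)
open import Data.List.Properties using (length-++; length-replicate; filter-++; filter-accept; filter-reject; filter-none)
open import Data.List.Relation.Unary.All using (All; []; _∷_; all?)
  renaming (tabulate to All-tabulate; lookup to All-lookup; map to All-map)
open import Data.List.Relation.Unary.All.Properties using (++⁺)
open import Data.List.Relation.Unary.Linked using (Linked; []; [-]; _∷_; linked?)
open import Data.List.Membership.Propositional using (_∈_)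
open import Data.List.Relation.Unary.Any using (here; there)
open import Data.Product using (_×_; _,_; proj₁; proj₂)
open import Data.Sum using (_⊎_; inj₁; inj₂; [_,_]; swap) renaming (map to ⊎-map; map₂ to ⊎-map₂)
open import Data.Empty using (⊥-elim)
open import Relation.Nullary using (¬_; Dec; yes; no)
open import Relation.Nullary.Decidable using (recompute; _×-dec_; _⊎-dec_; ¬?)
open import Relation.Binary.PropositionalEquality using (_≡_; _≢_; refl; sym; trans; cong; cong₂; subst; subst₂; module ≡-Reasoning)
open import Relation.Binary.Definitions using (tri<; tri≈; tri>)
open import Function.Base using (_∘_; id)
open import Function.Bundles using (_↔_; mk↔ₛ′)
open import Data.Nat.Tactic.RingSolver using (solve-∀)

mult-here : ∀ x xs → mult x (x ∷ xs) ≡ suc (mult x xs)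
mult-here x xs = cong length (filter-accept (x ≟_) {xs = xs} refl)

mult-there : ∀ {x y} xs → x ≢ y → mult x (y ∷ xs) ≡ mult x xs
mult-there xs x≢y = cong length (filter-reject (_ ≟_) {xs = xs} x≢y)

mult-++ : ∀ x xs ys → mult x (xs ++ ys) ≡ mult x xs + mult x ys
mult-++ x xs ys = trans (cong length (filter-++ (x ≟_) xs ys)) (length-++ (filter (x ≟_) xs))

mult-replicate : ∀ x d → mult x (replicate d x) ≡ d
mult-replicate x zero = refl
mult-replicate x (suc d) = trans (mult-here x (replicate d x)) (cong suc (mult-replicate x d))

mult-replicate-≢ : ∀ {x y} d → x ≢ y → mult x (replicate d y) ≡ 0
mult-replicate-≢ zero _ = refl
mult-replicate-≢ (suc d) x≢y = trans (mult-there _ x≢y) (mult-replicate-≢ d x≢y)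

mult-∉ : ∀ {x} xs → All (x ≢_) xs → mult x xs ≡ 0
mult-∉ {x} xs x∉ = cong length (filter-none (x ≟_) x∉)

mult≢0⇒∈ : ∀ {x} xs → mult x xs ≢ 0 → x ∈ xs
mult≢0⇒∈ [] h = ⊥-elim (h refl)
mult≢0⇒∈ {x} (y ∷ xs) h with x ≟ y
... | yes x≡y = here x≡y
... | no x≢y = there (mult≢0⇒∈ xs (λ e → h (trans (mult-there xs x≢y) e)))

head₀ : List ℕ → ℕ
head₀ [] = 0
head₀ (x ∷ _) = x

Sorted : List ℕ → Set
Sorted = Linked _≥_

sorted? : ∀ xs → Dec (Sorted xs)
sorted? = linked? (λ x y → y ≤? x)

sorted-head : ∀ {x xs} → Sorted (x ∷ xs) → head₀ xs ≤ x
sorted-head [-] = z≤n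
sorted-head (y≤x ∷ _) = y≤x

sorted-tail : ∀ {x xs} → Sorted (x ∷ xs) → Sorted xs
sorted-tail [-] = []
sorted-tail (_ ∷ s) = s

sorted-≤-head : ∀ {x xs} → Sorted (x ∷ xs) → All (_≤ x) xs
sorted-≤-head [-] = []
sorted-≤-head (y≤x ∷ s) = y≤x ∷ All-map (λ z≤y → ≤-trans z≤y y≤x) (sorted-≤-head s)

sorted-++ : ∀ {xs ys} k → Sorted xs → Sorted ys → All (k ≤_) xs → All (_≤ k) ys → Sorted (xs ++ ys)
sorted-++ {[]} _ _ sy _ _ = sy
sorted-++ {x ∷ []} {[]} _ _ _ _ _ = [-]
sorted-++ {x ∷ []} {y ∷ ys} _ _ sy (k≤x ∷ []) (y≤k ∷ _) = ≤-trans y≤k k≤x ∷ sy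
sorted-++ {x ∷ x' ∷ xs} k (x'≤x ∷ sx) sy (_ ∷ kxs) kys = x'≤x ∷ sorted-++ k sx sy kxs kys

sorted-replicate : ∀ d x → Sorted (replicate d x)
sorted-replicate zero x = []
sorted-replicate (suc zero) x = [-]
sorted-replicate (suc (suc d)) x = ≤-refl ∷ sorted-replicate (suc d) x

all-replicate : ∀ {P : ℕ → Set} d {x} → P x → All P (replicate d x)
all-replicate zero _ = []
all-replicate (suc d) px = px ∷ all-replicate d px

mult-above : ∀ {x y} xs → All (_≤ x) xs → x < y → mult y xs ≡ 0
mult-above xs bound x<y =
  mult-∉ xs (All-map (λ z≤x y≡z → <⇒≱ x<y (subst (_≤ _) (sym y≡z) z≤x)) bound)

sorted-ext : ∀ xs ys → Sorted xs → Sorted ys → (∀ k → mult k xs ≡ mult k ys) → xs ≡ ys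
sorted-ext [] [] _ _ _ = refl
sorted-ext [] (y ∷ ys) _ _ h = ⊥-elim (0≢1+n (trans (h y) (mult-here y ys)))
sorted-ext (x ∷ xs) [] _ _ h = ⊥-elim (0≢1+n (trans (sym (h x)) (mult-here x xs)))
sorted-ext (x ∷ xs) (y ∷ ys) sx sy h with <-cmp x y
... | tri< x<y _ _ = ⊥-elim (0≢1+n (begin
      0                ≡⟨ sym (trans (mult-there xs (>⇒≢ x<y)) (mult-above xs (sorted-≤-head sx) x<y)) ⟩
      mult y (x ∷ xs)  ≡⟨ h y ⟩
      mult y (y ∷ ys)  ≡⟨ mult-here y ys ⟩
      suc (mult y ys)  ∎))
  where open ≡-Reasoning
... | tri> _ _ y<x = ⊥-elim (0≢1+n (begin
      0                ≡⟨ sym (trans (mult-there ys (>⇒≢ y<x)) (mult-above ys (sorted-≤-head sy) y<x)) ⟩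
      mult x (y ∷ ys)  ≡⟨ sym (h x) ⟩
      mult x (x ∷ xs)  ≡⟨ mult-here x xs ⟩
      suc (mult x xs)  ∎))
  where open ≡-Reasoning
... | tri≈ _ refl _ = cong (x ∷_) (sorted-ext xs ys (sorted-tail sx) (sorted-tail sy) tail-mult)
  where
  tail-mult : ∀ k → mult k xs ≡ mult k ys
  tail-mult k with k ≟ x
  ... | yes refl = suc-injective (trans (sym (mult-here k xs)) (trans (h k) (mult-here k ys)))
  ... | no k≢x = trans (sym (mult-there xs k≢x)) (trans (h k) (mult-there ys k≢x))

sumTo : ℕ → (ℕ → ℕ) → ℕ
sumTo zero f = 0
sumTo (suc L) f = f (suc L) + sumTo L f

InRange : ℕ → ℕ → Set
InRange L k = 1 ≤ k × k ≤ L

inRange? : ∀ L k → Dec (InRange L k)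
inRange? L k = (1 ≤? k) ×-dec (k ≤? L)

inRange-top : ∀ L → InRange (suc L) (suc L)
inRange-top L = s≤s z≤n , ≤-refl

inRange-suc : ∀ {L k} → InRange L k → InRange (suc L) k
inRange-suc (1≤k , k≤L) = 1≤k , m≤n⇒m≤1+n k≤L

inRange-shift : ∀ {L k} → InRange L k → InRange (suc L) (suc k)
inRange-shift (_ , k≤L) = s≤s z≤n , s≤s k≤L

restrict : ℕ → (ℕ → ℕ) → ℕ → ℕ
restrict L f k with inRange? L k
... | yes _ = f k
... | no _ = 0

restrict-in : ∀ {L} f k → InRange L k → restrict L f k ≡ f k
restrict-in {L} f k r with inRange? L k
... | yes _ = refl
... | no ¬r = ⊥-elim (¬r r)

restrict-out : ∀ {L} f k → ¬ InRange L k → restrict L f k ≡ 0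
restrict-out {L} f k ¬r with inRange? L k
... | yes r = ⊥-elim (¬r r)
... | no _ = refl

restrict-zero : ∀ f k → restrict 0 f k ≡ 0
restrict-zero f k = restrict-out f k (λ (1≤k , k≤0) → <⇒≱ 1≤k k≤0)

restrict-top : ∀ L f → restrict (suc L) f (suc L) ≡ f (suc L)
restrict-top L f = restrict-in f (suc L) (inRange-top L)

restrict-beyond : ∀ L f → restrict L f (suc L) ≡ 0
restrict-beyond L f = restrict-out f (suc L) (λ (_ , L+1≤L) → <-irrefl refl L+1≤L)

restrict-cong : ∀ L {f g} k → (InRange L k → f k ≡ g k) → restrict L f k ≡ restrict L g k
restrict-cong L k f≡g with inRange? L k
... | yes r = f≡g r
... | no _ = refl

restrict-suc : ∀ L f k → k ≢ suc L → restrict L f k ≡ restrict (suc L) f k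
restrict-suc L f k k≢L+1 with inRange? L k
... | yes r = sym (restrict-in f k (inRange-suc r))
... | no ¬r = sym (restrict-out f k λ (1≤k , k≤L+1) → ¬r (1≤k , ≤-pred (≤∧≢⇒< k≤L+1 k≢L+1)))

sumTo-cong : ∀ L {f g} → (∀ k → InRange L k → f k ≡ g k) → sumTo L f ≡ sumTo L g
sumTo-cong zero _ = refl
sumTo-cong (suc L) f≗g =
  cong₂ _+_ (f≗g (suc L) (inRange-top L)) (sumTo-cong L (λ k r → f≗g k (inRange-suc r)))

sumTo-zero : ∀ L → sumTo L (λ _ → 0) ≡ 0
sumTo-zero zero = refl
sumTo-zero (suc L) = sumTo-zero L

sumTo-+ : ∀ L f g → sumTo L (λ k → f k + g k) ≡ sumTo L f + sumTo L g
sumTo-+ zero f g = refl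
sumTo-+ (suc L) f g = begin
  (f (suc L) + g (suc L)) + sumTo L (λ k → f k + g k)  ≡⟨ cong ((f (suc L) + g (suc L)) +_) (sumTo-+ L f g) ⟩
  (f (suc L) + g (suc L)) + (sumTo L f + sumTo L g)    ≡⟨ +-exchange (f (suc L)) (g (suc L)) (sumTo L f) (sumTo L g) ⟩
  (f (suc L) + sumTo L f) + (g (suc L) + sumTo L g)    ∎
  where
  open ≡-Reasoning
  +-exchange : ∀ a b c d → (a + b) + (c + d) ≡ (a + c) + (b + d)
  +-exchange = solve-∀

sumTo-shift : ∀ L f → sumTo (suc L) f ≡ f 1 + sumTo L (λ k → f (suc k))
sumTo-shift zero f = refl
sumTo-shift (suc L) f = begin
  f (suc (suc L)) + sumTo (suc L) f                        ≡⟨ cong (f (suc (suc L)) +_) (sumTo-shift L f) ⟩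
  f (suc (suc L)) + (f 1 + sumTo L (λ k → f (suc k)))      ≡⟨ x+[y+z]≡y+[x+z] (f (suc (suc L))) (f 1) _ ⟩
  f 1 + (f (suc (suc L)) + sumTo L (λ k → f (suc k)))      ∎
  where
  open ≡-Reasoning
  x+[y+z]≡y+[x+z] : ∀ x y z → x + (y + z) ≡ y + (x + z)
  x+[y+z]≡y+[x+z] = solve-∀

point : ℕ → ℕ → ℕ → ℕ
point q c j with j ≟ q
... | yes _ = c
... | no _ = 0

point-here : ∀ q c → point q c q ≡ c
point-here q c with q ≟ q
... | yes _ = refl
... | no q≢q = ⊥-elim (q≢q refl)

point-there : ∀ {q j} c → j ≢ q → point q c j ≡ 0
point-there {q} {j} c j≢q with j ≟ q
... | yes j≡q = ⊥-elim (j≢q j≡q)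
... | no _ = refl

point-zero : ∀ q j → point q 0 j ≡ 0
point-zero q j with j ≟ q
... | yes _ = refl
... | no _ = refl

sumTo-point : ∀ L q c → sumTo L (point q c) ≡ restrict L (λ _ → c) q
sumTo-point zero q c = sym (restrict-zero _ q)
sumTo-point (suc L) q c with suc L ≟ q
... | yes refl = begin
      c + sumTo L (point (suc L) c)         ≡⟨ cong (c +_) (sumTo-point L (suc L) c) ⟩
      c + restrict L (λ _ → c) (suc L)      ≡⟨ cong (c +_) (restrict-beyond L _) ⟩
      c + 0                                 ≡⟨ +-identityʳ c ⟩
      c                                     ≡⟨ sym (restrict-top L _) ⟩
      restrict (suc L) (λ _ → c) (suc L)    ∎
  where open ≡-Reasoning
... | no L+1≢q = trans (sumTo-point L q c) (restrict-suc L _ q (λ q≡L+1 → L+1≢q (sym q≡L+1)))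

-- The weight Σ_{k=1}^{L} k · f k: the size of the partition with multiplicities f.
weight : (ℕ → ℕ) → ℕ → ℕ
weight f L = sumTo L (λ k → k * f k)

weight-cong : ∀ L {f g} → (∀ k → InRange L k → f k ≡ g k) → weight f L ≡ weight g L
weight-cong L f≗g = sumTo-cong L (λ k r → cong (k *_) (f≗g k r))

weight-+ : ∀ L f g → weight (λ k → f k + g k) L ≡ weight f L + weight g L
weight-+ L f g = trans (sumTo-cong L (λ k _ → *-distribˡ-+ k (f k) (g k))) (sumTo-+ L _ _)

weight-point : ∀ L q c → InRange L q ⊎ c ≡ 0 → weight (point q c) L ≡ q * c
weight-point L q c fits = trans (sumTo-cong L scale) (trans (sumTo-point L q (q * c)) (restricted fits))
  where
  scale : ∀ k → InRange L k → k * point q c k ≡ point q (q * c) k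
  scale k _ with k ≟ q
  ... | yes refl = refl
  ... | no _ = *-zeroʳ k
  restricted : InRange L q ⊎ c ≡ 0 → restrict L (λ _ → q * c) q ≡ q * c
  restricted (inj₁ r) = restrict-in _ q r
  restricted (inj₂ refl) with inRange? L q
  ... | yes _ = refl
  ... | no _ = sym (*-zeroʳ q)

term≤weight : ∀ L f k → InRange L k → k * f k ≤ weight f L
term≤weight zero f k (1≤k , k≤0) = ⊥-elim (<⇒≱ 1≤k k≤0)
term≤weight (suc L) f k (1≤k , k≤L+1) with k ≟ suc L
... | yes refl = m≤m+n _ _
... | no k≢L+1 = ≤-trans (term≤weight L f k (1≤k , ≤-pred (≤∧≢⇒< k≤L+1 k≢L+1))) (m≤n+m _ _)

-- peeling off the part 1 and lowering every other part by one
weight-shift : ∀ L f → weight f (suc L) ≡ f 1 + (sumTo L (λ k → f (suc k)) + weight (λ k → f (suc k)) L)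
weight-shift L f = begin
  weight f (suc L)                                                        ≡⟨ sumTo-shift L _ ⟩
  1 * f 1 + sumTo L (λ k → suc k * f (suc k))                             ≡⟨ cong₂ _+_ (*-identityˡ (f 1)) (sumTo-+ L _ _) ⟩
  f 1 + (sumTo L (λ k → f (suc k)) + weight (λ k → f (suc k)) L)          ∎
  where open ≡-Reasoning

expand : (ℕ → ℕ) → ℕ → List ℕ
expand f zero = []
expand f (suc L) = replicate (f (suc L)) (suc L) ++ expand f L

expand-inRange : ∀ f L → All (InRange L) (expand f L)
expand-inRange f zero = []
expand-inRange f (suc L) =
  ++⁺ (all-replicate (f (suc L)) (inRange-top L)) (All-map inRange-suc (expand-inRange f L))

expand-sorted : ∀ f L → Sorted (expand f L)
expand-sorted f zero = []
expand-sorted f (suc L) =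
  sorted-++ (suc L) (sorted-replicate (f (suc L)) (suc L)) (expand-sorted f L)
    (all-replicate (f (suc L)) ≤-refl) (All-map (λ (_ , k≤L) → m≤n⇒m≤1+n k≤L) (expand-inRange f L))

expand-mult : ∀ f L k → mult k (expand f L) ≡ restrict L f k
expand-mult f zero k = sym (restrict-zero f k)
expand-mult f (suc L) k with k ≟ suc L
... | yes refl = begin
      mult k (replicate (f k) k ++ expand f L)           ≡⟨ mult-++ k (replicate (f k) k) (expand f L) ⟩
      mult k (replicate (f k) k) + mult k (expand f L)   ≡⟨ cong₂ _+_ (mult-replicate k (f k)) (expand-mult f L k) ⟩
      f k + restrict L f k                               ≡⟨ cong (f k +_) (restrict-beyond L f) ⟩
      f k + 0                                            ≡⟨ +-identityʳ (f k) ⟩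
      f k                                                ≡⟨ sym (restrict-top L f) ⟩
      restrict (suc L) f k                               ∎
  where open ≡-Reasoning
... | no k≢L+1 = trans (mult-++ k (replicate (f (suc L)) (suc L)) (expand f L))
                   (trans (cong₂ _+_ (mult-replicate-≢ (f (suc L)) k≢L+1) (expand-mult f L k)) (restrict-suc L f k k≢L+1))

sum-replicate : ∀ d k → sum (replicate d k) ≡ k * d
sum-replicate zero k = sym (*-zeroʳ k)
sum-replicate (suc d) k = trans (cong (k +_) (sum-replicate d k)) (sym (*-suc k d))

expand-sum : ∀ f L → sum (expand f L) ≡ weight f L
expand-sum f zero = refl
expand-sum f (suc L) =
  trans (sum-++ (replicate (f (suc L)) (suc L)) (expand f L))
        (cong₂ _+_ (sum-replicate (f (suc L)) (suc L)) (expand-sum f L))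

-- a partition lists only the parts of nonzero multiplicity
expand-all : ∀ {P : ℕ → Set} f L → (∀ k → InRange L k → f k ≢ 0 → P k) → All P (expand f L)
expand-all f zero _ = []
expand-all {P} f (suc L) pf =
  ++⁺ (copies (f (suc L)) (pf (suc L) (inRange-top L))) (expand-all f L (λ k r → pf k (inRange-suc r)))
  where
  copies : ∀ d → (d ≢ 0 → P (suc L)) → All P (replicate d (suc L))
  copies zero _ = []
  copies (suc d) p = all-replicate (suc d) (p (λ ()))

mults : List ℕ → ℕ → ℕ
mults xs k = mult k xs

length≤sum : ∀ xs → All (1 ≤_) xs → length xs ≤ sum xs
length≤sum [] [] = z≤n
length≤sum (x ∷ xs) (1≤x ∷ pos) = +-mono-≤ 1≤x (length≤sum xs pos)

parts-inRange : ∀ {n} xs → All (1 ≤_) xs → sum xs ≡ n → All (InRange n) xs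
parts-inRange {n} xs pos refl = bounded xs pos
  where
  bounded : ∀ ys → All (1 ≤_) ys → All (InRange (sum ys)) ys
  bounded [] [] = []
  bounded (y ∷ ys) (1≤y ∷ pos) =
    (1≤y , m≤m+n y (sum ys)) ∷ All-map (λ (1≤z , z≤s) → 1≤z , ≤-trans z≤s (m≤n+m (sum ys) y)) (bounded ys pos)

mult-outside : ∀ {n k} xs → All (InRange n) xs → ¬ InRange n k → mult k xs ≡ 0
mult-outside {n} xs inR ¬r = mult-∉ xs (All-map (λ r k≡x → ¬r (subst (InRange n) (sym k≡x) r)) inR)

mults-restrict : ∀ {n} xs → All (InRange n) xs → ∀ k → restrict n (mults xs) k ≡ mult k xs
mults-restrict {n} xs inR k with inRange? n k
... | yes _ = refl
... | no ¬r = sym (mult-outside xs inR ¬r)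

expand-mults : ∀ {n} xs → Sorted xs → All (InRange n) xs → expand (mults xs) n ≡ xs
expand-mults {n} xs s inR =
  sorted-ext _ xs (expand-sorted (mults xs) n) s (λ k → trans (expand-mult (mults xs) n k) (mults-restrict xs inR k))

weight-mults : ∀ {n} xs → Sorted xs → All (InRange n) xs → sum xs ≡ n → weight (mults xs) n ≡ n
weight-mults {n} xs s inR total = trans (sym (expand-sum (mults xs) n)) (trans (cong sum (expand-mults xs s inR)) total)

sorted : ∀ {n P} (π : PartitionWith n P) → Sorted (PartitionWith.parts π)
sorted (partition ps s _ _ _) = recompute (sorted? ps) s

total′ : ∀ {n P} (π : PartitionWith n P) → sum (PartitionWith.parts π) ≡ n
total′ {n} (partition ps _ _ t _) = recompute (sum ps ≟ n) t

inRange : ∀ {n P} (π : PartitionWith n P) → All (InRange n) (PartitionWith.parts π)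
inRange π@(partition ps _ pos _ _) = parts-inRange ps (recompute (all? (1 ≤?_) ps) pos) (total′ π)

length≤n : ∀ {n P} (π : PartitionWith n P) → length (PartitionWith.parts π) ≤ n
length≤n π@(partition ps _ pos _ _) = subst (length ps ≤_) (total′ π) (length≤sum ps (recompute (all? (1 ≤?_) ps) pos))

mults-bounded : ∀ {n P} (π : PartitionWith n P) j → j * mult j (PartitionWith.parts π) ≤ n
mults-bounded {n} π@(partition xs _ _ _ _) j with inRange? n j
... | yes r = ≤-trans (term≤weight n (mults xs) j r) (≤-reflexive (weight-mults xs (sorted π) (inRange π) (total′ π)))
... | no ¬r = subst (λ m → j * m ≤ n) (sym (mult-outside xs (inRange π) ¬r)) (subst (_≤ n) (sym (*-zeroʳ j)) z≤n)

mults-support : ∀ {n P} (π : PartitionWith n P) j → mult j (PartitionWith.parts π) ≢ 0 → j ≤ n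
mults-support π@(partition xs _ _ _ _) j m≢0 = proj₂ (All-lookup (inRange π) (mult≢0⇒∈ xs m≢0))

partition-ext : ∀ {n P} (π ρ : PartitionWith n P) →
                (∀ k → mult k (PartitionWith.parts π) ≡ mult k (PartitionWith.parts ρ)) → π ≡ ρ
partition-ext π ρ same with sorted-ext _ _ (sorted π) (sorted ρ) same
partition-ext (partition ps _ _ _ _) (partition .ps _ _ _ _) _ | refl = refl

expandPartition : ∀ {n P} f → .(weight f n ≡ n) → .(P (expand f n)) → PartitionWith n P
expandPartition {n} f w p =
  partition (expand f n) (expand-sorted f n) (All-map proj₁ (expand-inRange f n)) (trans (expand-sum f n) w) p

-- entry xs k is the k-th entry of xs (counting from 1), and 0 outside
entry : List ℕ → ℕ → ℕ
entry [] _ = 0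
entry (x ∷ xs) zero = 0
entry (x ∷ xs) (suc zero) = x
entry (x ∷ xs) (suc (suc k)) = entry xs (suc k)

values : (ℕ → ℕ) → ℕ → List ℕ
values f zero = []
values f (suc n) = f 1 ∷ values (λ k → f (suc k)) n

length-values : ∀ f n → length (values f n) ≡ n
length-values f zero = refl
length-values f (suc n) = cong suc (length-values _ n)

entry-values : ∀ f n k → InRange n k → entry (values f n) k ≡ f k
entry-values f zero k (1≤k , k≤0) = ⊥-elim (<⇒≱ 1≤k k≤0)
entry-values f (suc n) (suc zero) _ = refl
entry-values f (suc n) (suc (suc k)) (_ , s≤s k<n) = entry-values (λ k → f (suc k)) n (suc k) (s≤s z≤n , k<n)

entry-∷ : ∀ x xs {k} → 1 ≤ k → entry (x ∷ xs) (suc k) ≡ entry xs k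
entry-∷ x xs {suc k} _ = refl

values-cong : ∀ n {f g} → (∀ k → InRange n k → f k ≡ g k) → values f n ≡ values g n
values-cong zero _ = refl
values-cong (suc n) f≗g =
  cong₂ _∷_ (f≗g 1 (≤-refl , s≤s z≤n)) (values-cong n (λ k r → f≗g (suc k) (inRange-shift r)))

values-entry : ∀ xs → values (entry xs) (length xs) ≡ xs
values-entry [] = refl
values-entry (x ∷ xs) =
  cong (x ∷_) (trans (values-cong (length xs) (λ k (1≤k , _) → entry-∷ x xs 1≤k)) (values-entry xs))

entry-all : ∀ {P : ℕ → Set} xs k → P 0 → All P xs → P (entry xs k)
entry-all [] _ p0 [] = p0
entry-all (x ∷ xs) zero p0 _ = p0
entry-all (x ∷ xs) (suc zero) _ (px ∷ _) = px
entry-all (x ∷ xs) (suc (suc k)) p0 (_ ∷ pxs) = entry-all xs (suc k) p0 pxs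

values-all : ∀ {P : ℕ → Set} f n → (∀ k → InRange n k → P (f k)) → All P (values f n)
values-all f zero _ = []
values-all f (suc n) pf = pf 1 (≤-refl , s≤s z≤n) ∷ values-all _ n (λ k r → pf (suc k) (inRange-shift r))

sum-entry : ∀ xs → sumTo (length xs) (entry xs) ≡ sum xs
sum-entry [] = refl
sum-entry (x ∷ xs) = begin
  sumTo (suc (length xs)) (entry (x ∷ xs))
    ≡⟨ sumTo-shift (length xs) _ ⟩
  x + sumTo (length xs) (λ k → entry (x ∷ xs) (suc k))
    ≡⟨ cong (x +_) (sumTo-cong (length xs) (λ k (1≤k , _) → entry-∷ x xs 1≤k)) ⟩
  x + sumTo (length xs) (entry xs)
    ≡⟨ cong (x +_) (sum-entry xs) ⟩
  x + sum xs
    ∎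
  where open ≡-Reasoning

-- Conjugation: gaps and suffix sums

gaps : List ℕ → List ℕ
gaps [] = []
gaps (x ∷ xs) = (x ∸ head₀ xs) ∷ gaps xs

suffixSums : List ℕ → List ℕ
suffixSums [] = []
suffixSums (d ∷ ds) = (d + head₀ (suffixSums ds)) ∷ suffixSums ds

head-suffixSums : ∀ ds → head₀ (suffixSums ds) ≡ sum ds
head-suffixSums [] = refl
head-suffixSums (d ∷ ds) = cong (d +_) (head-suffixSums ds)

gaps-suffixSums : ∀ ds → gaps (suffixSums ds) ≡ ds
gaps-suffixSums [] = refl
gaps-suffixSums (d ∷ ds) = cong₂ _∷_ (m+n∸n≡m d (head₀ (suffixSums ds))) (gaps-suffixSums ds)

suffixSums-gaps : ∀ xs → Sorted xs → suffixSums (gaps xs) ≡ xs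
suffixSums-gaps [] _ = refl
suffixSums-gaps (x ∷ xs) s = cong₂ _∷_ head-eq (suffixSums-gaps xs (sorted-tail s))
  where
  head-≤ : head₀ xs ≤ x
  head-≤ = sorted-head s
  head-eq : x ∸ head₀ xs + head₀ (suffixSums (gaps xs)) ≡ x
  head-eq = trans (cong (x ∸ head₀ xs +_) (cong head₀ (suffixSums-gaps xs (sorted-tail s)))) (m∸n+n≡m head-≤)

suffixSums-sorted : ∀ ds → Sorted (suffixSums ds)
suffixSums-sorted [] = []
suffixSums-sorted (d ∷ []) = [-]
suffixSums-sorted (d ∷ d' ∷ ds) = m≤n+m _ d ∷ suffixSums-sorted (d' ∷ ds)

length-gaps : ∀ xs → length (gaps xs) ≡ length xs
length-gaps [] = refl
length-gaps (x ∷ xs) = cong suc (length-gaps xs)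

length-suffixSums : ∀ ds → length (suffixSums ds) ≡ length ds
length-suffixSums [] = refl
length-suffixSums (d ∷ ds) = cong suc (length-suffixSums ds)

-- the size of the conjugate: Σ k · dₖ = Σ (suffix sums)
weight-entry : ∀ ds → weight (entry ds) (length ds) ≡ sum (suffixSums ds)
weight-entry [] = refl
weight-entry (d ∷ ds) = begin
  weight (entry (d ∷ ds)) (suc (length ds))
    ≡⟨ weight-shift (length ds) _ ⟩
  d + (sumTo (length ds) (λ k → entry (d ∷ ds) (suc k)) + weight (λ k → entry (d ∷ ds) (suc k)) (length ds))
    ≡⟨ cong (λ t → d + t) (cong₂ _+_ (sumTo-cong (length ds) shift) (weight-cong (length ds) shift)) ⟩
  d + (sumTo (length ds) (entry ds) + weight (entry ds) (length ds))
    ≡⟨ cong (λ t → d + t) (cong₂ _+_ (trans (sum-entry ds) (sym (head-suffixSums ds))) (weight-entry ds)) ⟩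
  d + (head₀ (suffixSums ds) + sum (suffixSums ds))
    ≡⟨ sym (+-assoc d _ _) ⟩
  sum (suffixSums (d ∷ ds))
    ∎
  where
  open ≡-Reasoning
  shift : ∀ k → InRange (length ds) k → entry (d ∷ ds) (suc k) ≡ entry ds k
  shift k (1≤k , _) = entry-∷ d ds 1≤k

padTo : ℕ → List ℕ → List ℕ
padTo n xs = xs ++ replicate (n ∸ length xs) 0

padTo-sorted : ∀ n xs → Sorted xs → Sorted (padTo n xs)
padTo-sorted n xs s =
  sorted-++ 0 s (sorted-replicate _ 0) (All-tabulate λ _ → z≤n) (all-replicate (n ∸ length xs) ≤-refl)

length-padTo : ∀ n xs → length xs ≤ n → length (padTo n xs) ≡ n
length-padTo n xs len≤n =
  trans (length-++ xs) (trans (cong (length xs +_) (length-replicate (n ∸ length xs))) (m+[n∸m]≡n len≤n))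

sum-padTo : ∀ n xs → sum (padTo n xs) ≡ sum xs
sum-padTo n xs = trans (sum-++ xs _) (trans (cong (sum xs +_) (sum-replicate (n ∸ length xs) 0)) (+-identityʳ _))

dropZeros : List ℕ → List ℕ
dropZeros [] = []
dropZeros (zero ∷ xs) = dropZeros xs
dropZeros (suc x ∷ xs) = suc x ∷ dropZeros xs

dropZeros-∈ : ∀ {x} xs → x ∈ dropZeros xs → x ∈ xs
dropZeros-∈ (zero ∷ xs) x∈ = there (dropZeros-∈ xs x∈)
dropZeros-∈ (suc y ∷ xs) (here x≡y) = here x≡y
dropZeros-∈ (suc y ∷ xs) (there x∈) = there (dropZeros-∈ xs x∈)

dropZeros-positive : ∀ xs → All (1 ≤_) (dropZeros xs)
dropZeros-positive [] = []
dropZeros-positive (zero ∷ xs) = dropZeros-positive xs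
dropZeros-positive (suc x ∷ xs) = s≤s z≤n ∷ dropZeros-positive xs

dropZeros-sorted : ∀ xs → Sorted xs → Sorted (dropZeros xs)
dropZeros-sorted [] s = s
dropZeros-sorted (zero ∷ xs) s = dropZeros-sorted xs (sorted-tail s)
dropZeros-sorted (suc x ∷ xs) s = cons (head-bound xs (sorted-≤-head s)) (dropZeros-sorted xs (sorted-tail s))
  where
  head-bound : ∀ ys → All (_≤ suc x) ys → head₀ (dropZeros ys) ≤ suc x
  head-bound [] [] = z≤n
  head-bound (zero ∷ ys) (_ ∷ bs) = head-bound ys bs
  head-bound (suc y ∷ ys) (b ∷ _) = b
  cons : ∀ {ys} → head₀ ys ≤ suc x → Sorted ys → Sorted (suc x ∷ ys)
  cons {[]} _ _ = [-]
  cons {y ∷ ys} y≤x s = y≤x ∷ s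

sum-dropZeros : ∀ xs → sum (dropZeros xs) ≡ sum xs
sum-dropZeros [] = refl
sum-dropZeros (zero ∷ xs) = sum-dropZeros xs
sum-dropZeros (suc x ∷ xs) = cong (suc x +_) (sum-dropZeros xs)

dropZeros-replicate : ∀ k → dropZeros (replicate k 0) ≡ []
dropZeros-replicate zero = refl
dropZeros-replicate (suc k) = dropZeros-replicate k

dropZeros-++-zeros : ∀ xs k → All (1 ≤_) xs → dropZeros (xs ++ replicate k 0) ≡ xs
dropZeros-++-zeros [] k [] = dropZeros-replicate k
dropZeros-++-zeros (suc x ∷ xs) k (_ ∷ pos) = cong (suc x ∷_) (dropZeros-++-zeros xs k pos)

padTo-dropZeros : ∀ xs → Sorted xs → padTo (length xs) (dropZeros xs) ≡ xs
padTo-dropZeros [] _ = refl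
padTo-dropZeros (zero ∷ xs) s = trans (cong (padTo (suc (length xs))) no-positive) (cong (0 ∷_) (sym (zeros xs s)))
  where
  zeros : ∀ ys → Sorted (0 ∷ ys) → ys ≡ replicate (length ys) 0
  zeros [] _ = refl
  zeros (zero ∷ ys) (z≤n ∷ s) = cong (0 ∷_) (zeros ys s)
  no-positive : dropZeros xs ≡ []
  no-positive = trans (cong dropZeros (zeros xs s)) (dropZeros-replicate (length xs))
padTo-dropZeros (suc x ∷ xs) s = cong (suc x ∷_) (padTo-dropZeros xs (sorted-tail s))

module _ {a₁ a₂ : ℕ} where

  InS-0 : InS a₁ a₂ 0
  InS-0 = 0 , 0 , refl

  InS-+ : ∀ {x y} → InS a₁ a₂ x → InS a₁ a₂ y → InS a₁ a₂ (x + y)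
  InS-+ (x₁ , x₂ , refl) (y₁ , y₂ , refl) = x₁ + y₁ , x₂ + y₂ , regroup x₁ x₂ y₁ y₂ a₁ a₂
    where
    regroup : ∀ x₁ x₂ y₁ y₂ a₁ a₂ →
              (x₁ + y₁) * a₁ + (x₂ + y₂) * a₂ ≡ (x₁ * a₁ + x₂ * a₂) + (y₁ * a₁ + y₂ * a₂)
    regroup = solve-∀

  InS-sum : ∀ ds → All (InS a₁ a₂) ds → InS a₁ a₂ (sum ds)
  InS-sum [] [] = InS-0
  InS-sum (d ∷ ds) (d∈S ∷ ds∈S) = InS-+ d∈S (InS-sum ds ds∈S)

  mults-InS : ∀ xs → CondII a₁ a₂ xs → ∀ k → InS a₁ a₂ (mult k xs)
  mults-InS xs cond k with mult k xs ≟ 0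
  ... | yes m≡0 = subst (InS a₁ a₂) (sym m≡0) InS-0
  ... | no m≢0 = cond (mult≢0⇒∈ xs m≢0)

  expand-CondII : ∀ f L → (∀ k → InRange L k → InS a₁ a₂ (f k)) → CondII a₁ a₂ (expand f L)
  expand-CondII f L f∈S {x} _ with inRange? L x | expand-mult f L x
  ... | yes r | m≡ = subst (InS a₁ a₂) (sym m≡) (f∈S x r)
  ... | no _ | m≡ = subst (InS a₁ a₂) (sym m≡) InS-0

  gaps-InS : ∀ n xs → Sorted xs → CondI a₁ a₂ xs → All (InS a₁ a₂) (gaps (padTo n xs))
  gaps-InS n xs s (parts∈S , diffs∈S) =
    gapsOf (padTo n xs) (++⁺ (All-tabulate inj₂) (all-replicate _ (inj₁ refl))) (padTo-sorted n xs s)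
    where
    PartOr0 : ℕ → Set
    PartOr0 z = z ≡ 0 ⊎ z ∈ xs
    diff∈S : ∀ {x y} → PartOr0 x → PartOr0 y → y ≤ x → InS a₁ a₂ (x ∸ y)
    diff∈S {y = y} (inj₁ refl) _ _ = subst (InS a₁ a₂) (sym (0∸n≡0 y)) InS-0
    diff∈S (inj₂ x∈) (inj₁ refl) _ = All-lookup parts∈S x∈
    diff∈S (inj₂ x∈) (inj₂ y∈) y≤x = diffs∈S x∈ y∈ y≤x
    gapsOf : ∀ ys → All PartOr0 ys → Sorted ys → All (InS a₁ a₂) (gaps ys)
    gapsOf [] [] _ = []
    gapsOf (y ∷ []) (py ∷ []) _ = diff∈S py (inj₁ refl) z≤n ∷ []
    gapsOf (y ∷ y' ∷ ys) (py ∷ py' ∷ pys) (y'≤y ∷ s) = diff∈S py py' y'≤y ∷ gapsOf (y' ∷ ys) (py' ∷ pys) s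

  suffix-complement : ∀ ds → All (InS a₁ a₂) ds → ∀ {m} → m ∈ suffixSums ds →
                      m ≤ sum ds × InS a₁ a₂ (sum ds ∸ m)
  suffix-complement (d ∷ ds) _ (here refl) rewrite head-suffixSums ds =
    ≤-refl , subst (InS a₁ a₂) (sym (n∸n≡0 (d + sum ds))) InS-0
  suffix-complement (d ∷ ds) (d∈S ∷ ds∈S) (there m∈) with suffix-complement ds ds∈S m∈
  ... | m≤ , rest∈S = ≤-trans m≤ (m≤n+m _ d) , subst (InS a₁ a₂) (sym (+-∸-assoc d m≤)) (InS-+ d∈S rest∈S)

  suffixSums-InS : ∀ ds → All (InS a₁ a₂) ds → All (InS a₁ a₂) (suffixSums ds)
  suffixSums-InS [] [] = []
  suffixSums-InS (d ∷ ds) (d∈S ∷ ds∈S) =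
    subst (InS a₁ a₂) (cong (d +_) (sym (head-suffixSums ds))) (InS-sum (d ∷ ds) (d∈S ∷ ds∈S)) ∷ suffixSums-InS ds ds∈S

  suffixSums-diffs : ∀ ds → All (InS a₁ a₂) ds → ∀ {l m} → l ∈ suffixSums ds → m ∈ suffixSums ds → m ≤ l →
                     InS a₁ a₂ (l ∸ m)
  suffixSums-diffs (d ∷ ds) _ (here refl) (here refl) _ = subst (InS a₁ a₂) (sym (n∸n≡0 (d + head₀ (suffixSums ds)))) InS-0
  suffixSums-diffs (d ∷ ds) ds∈S (here refl) (there m∈) _ rewrite head-suffixSums ds =
    proj₂ (suffix-complement (d ∷ ds) ds∈S (there m∈))
  suffixSums-diffs (d ∷ ds) (_ ∷ ds∈S) (there l∈) (here refl) _ rewrite head-suffixSums ds =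
    subst (InS a₁ a₂) (sym (m≤n⇒m∸n≡0 (≤-trans (proj₁ (suffix-complement ds ds∈S l∈)) (m≤n+m _ d)))) InS-0
  suffixSums-diffs (d ∷ ds) (_ ∷ ds∈S) (there l∈) (there m∈) m≤l = suffixSums-diffs ds ds∈S l∈ m∈ m≤l

  suffixSums-CondI : ∀ ds → All (InS a₁ a₂) ds → CondI a₁ a₂ (dropZeros (suffixSums ds))
  suffixSums-CondI ds ds∈S =
    All-tabulate (λ l∈ → All-lookup (suffixSums-InS ds ds∈S) (dropZeros-∈ _ l∈)) ,
    λ l∈ m∈ m≤l → suffixSums-diffs ds ds∈S (dropZeros-∈ _ l∈) (dropZeros-∈ _ m∈) m≤l

length-gaps-padTo : ∀ n xs → length xs ≤ n → length (gaps (padTo n xs)) ≡ n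
length-gaps-padTo n xs len≤n = trans (length-gaps (padTo n xs)) (length-padTo n xs len≤n)

-- the conjugate of λ has multiplicity λₖ - λₖ₊₁ of k; this is its size
weight-gaps : ∀ n xs → Sorted xs → length xs ≤ n → weight (entry (gaps (padTo n xs))) n ≡ sum xs
weight-gaps n xs s len≤n = begin
  weight (entry ds) n                    ≡⟨ cong (weight (entry ds)) (sym length-ds) ⟩
  weight (entry ds) (length ds)          ≡⟨ weight-entry ds ⟩
  sum (suffixSums (gaps (padTo n xs)))   ≡⟨ cong sum (suffixSums-gaps (padTo n xs) (padTo-sorted n xs s)) ⟩
  sum (padTo n xs)                       ≡⟨ sum-padTo n xs ⟩
  sum xs                                 ∎
  where
  open ≡-Reasoning
  ds = gaps (padTo n xs)
  length-ds : length ds ≡ n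
  length-ds = length-gaps-padTo n xs len≤n

-- the conjugate of the partition with multiplicities f has parts Σ_{j ≥ k} f j; this is its size
sum-conjugate : ∀ f n → sum (dropZeros (suffixSums (values f n))) ≡ weight f n
sum-conjugate f n = begin
  sum (dropZeros (suffixSums (values f n)))  ≡⟨ sum-dropZeros (suffixSums (values f n)) ⟩
  sum (suffixSums (values f n))              ≡⟨ sym (weight-entry (values f n)) ⟩
  weight (entry (values f n)) (length (values f n))   ≡⟨ cong (weight (entry (values f n))) (length-values f n) ⟩
  weight (entry (values f n)) n              ≡⟨ weight-cong n (entry-values f n) ⟩
  weight f n                                 ∎
  where open ≡-Reasoning

values-mults-expand : ∀ f n → values (mults (expand f n)) n ≡ values f n
values-mults-expand f n = values-cong n (λ k r → trans (expand-mult f n k) (restrict-in f k r))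

module Conjugation (n a₁ a₂ : ℕ) where

  conjugateI : PartitionWith n (CondI a₁ a₂) → PartitionWith n (CondII a₁ a₂)
  conjugateI π@(partition xs s _ total cond) =
    expandPartition (entry ds)
      (trans (weight-gaps n xs s (length≤n π)) total)
      (expand-CondII (entry ds) n (λ k _ → entry-all ds k InS-0 (gaps-InS n xs s cond)))
    where ds = gaps (padTo n xs)

  conjugateII : PartitionWith n (CondII a₁ a₂) → PartitionWith n (CondI a₁ a₂)
  conjugateII π@(partition xs _ _ _ cond) =
    partition (dropZeros (suffixSums v)) (dropZeros-sorted (suffixSums v) (suffixSums-sorted v)) (dropZeros-positive (suffixSums v))
      (trans (sum-conjugate (mults xs) n) (weight-mults xs (sorted π) (inRange π) (total′ π)))
      (suffixSums-CondI v (values-all (mults xs) n (λ k _ → mults-InS xs cond k)))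
    where v = values (mults xs) n

  conjugateI∘II : ∀ π → conjugateI (conjugateII π) ≡ π
  conjugateI∘II π@(partition xs _ _ _ _) = partition-ext _ π λ k → begin
    mult k (expand (entry (gaps (padTo n (dropZeros (suffixSums v))))) n)
      ≡⟨ expand-mult _ n k ⟩
    restrict n (entry (gaps (padTo n (dropZeros (suffixSums v))))) k
      ≡⟨ cong (λ ys → restrict n (entry (gaps ys)) k) padded ⟩
    restrict n (entry (gaps (suffixSums v))) k
      ≡⟨ cong (λ ys → restrict n (entry ys) k) (gaps-suffixSums v) ⟩
    restrict n (entry v) k
      ≡⟨ restrict-cong n k (entry-values (mults xs) n k) ⟩
    restrict n (mults xs) k
      ≡⟨ mults-restrict xs (inRange π) k ⟩
    mult k xs
      ∎
    where
    open ≡-Reasoning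
    v = values (mults xs) n
    padded : padTo n (dropZeros (suffixSums v)) ≡ suffixSums v
    padded = subst (λ L → padTo L (dropZeros (suffixSums v)) ≡ suffixSums v)
               (trans (length-suffixSums v) (length-values (mults xs) n))
               (padTo-dropZeros (suffixSums v) (suffixSums-sorted v))

  conjugateII∘I : ∀ π → conjugateII (conjugateI π) ≡ π
  conjugateII∘I π@(partition xs _ _ _ _) = partition-ext _ π λ k → cong (mult k) (begin
    dropZeros (suffixSums (values (mults (expand (entry ds) n)) n))
      ≡⟨ cong (dropZeros ∘ suffixSums) (values-mults-expand (entry ds) n) ⟩
    dropZeros (suffixSums (values (entry ds) n))
      ≡⟨ cong (dropZeros ∘ suffixSums) unpadded ⟩
    dropZeros (suffixSums ds)
      ≡⟨ cong dropZeros (suffixSums-gaps (padTo n xs) (padTo-sorted n xs (sorted π))) ⟩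
    dropZeros (padTo n xs)
      ≡⟨ dropZeros-++-zeros xs _ (All-map proj₁ (inRange π)) ⟩
    xs
      ∎)
    where
    open ≡-Reasoning
    ds = gaps (padTo n xs)
    unpadded : values (entry ds) n ≡ ds
    unpadded = subst (λ L → values (entry ds) L ≡ ds) (length-gaps-padTo n xs (length≤n π)) (values-entry ds)

  conjugation : PartitionWith n (CondI a₁ a₂) ↔ PartitionWith n (CondII a₁ a₂)
  conjugation = mk↔ₛ′ conjugateI conjugateII conjugateI∘II conjugateII∘I

-- Base-b digits

module Digits (b : ℕ) .{{_ : NonZero b}} where

  digit : ℕ → ℕ → ℕ
  digit zero M = M % b
  digit (suc e) M = digit e (M / b)

  digit<b : ∀ e M → digit e M < b
  digit<b zero M = m%n<n M b
  digit<b (suc e) M = digit<b e (M / b)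

  digit-small : ∀ e M → M < b ^ e → digit e M ≡ 0
  digit-small zero M M<1 = subst (λ x → x % b ≡ 0) (sym (n<1⇒n≡0 M<1)) (m<n⇒m%n≡m (>-nonZero⁻¹ b))
  digit-small (suc e) M M<b^e+1 = digit-small e (M / b) (m<n*o⇒m/o<n (subst (M <_) (*-comm b (b ^ e)) M<b^e+1))

  digit-zero : ∀ e → digit e 0 ≡ 0
  digit-zero e = digit-small e 0 (m^n>0 b e)

  private
    pow-suc : ∀ v f → v * b ^ suc f ≡ v * b ^ f * b
    pow-suc v f = trans (cong (v *_) (*-comm b (b ^ f))) (sym (*-assoc v (b ^ f) b))

    /-shift : ∀ A v f → (A + v * b ^ suc f) / b ≡ A / b + v * b ^ f
    /-shift A v f = trans (cong (λ t → (A + t) / b) (pow-suc v f))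
                          (trans (+-distrib-/-∣ʳ A (n∣m*n (v * b ^ f))) (cong (A / b +_) (m*n/n≡m (v * b ^ f) b)))

  digit-add-here : ∀ f A v → digit f A ≡ 0 → v < b → digit f (A + v * b ^ f) ≡ v
  digit-add-here zero A v A₀≡0 v<b = begin
    (A + v * 1) % b  ≡⟨ cong (λ t → (A + t) % b) (*-identityʳ v) ⟩
    (A + v) % b      ≡⟨ %-remove-+ˡ v (m%n≡0⇒n∣m A b A₀≡0) ⟩
    v % b            ≡⟨ m<n⇒m%n≡m v<b ⟩
    v                ∎
    where open ≡-Reasoning
  digit-add-here (suc f) A v A₀≡0 v<b =
    trans (cong (digit f) (/-shift A v f)) (digit-add-here f (A / b) v A₀≡0 v<b)

  digit-add-there : ∀ e f A v → e ≢ f → digit f A ≡ 0 → v < b → digit e (A + v * b ^ f) ≡ digit e A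
  digit-add-there zero zero A v e≢f _ _ = ⊥-elim (e≢f refl)
  digit-add-there (suc e) zero A v _ A₀≡0 v<b = cong (digit e) (begin
    (A + v * 1) / b  ≡⟨ cong (λ t → (A + t) / b) (*-identityʳ v) ⟩
    (A + v) / b      ≡⟨ +-distrib-/-∣ˡ v (m%n≡0⇒n∣m A b A₀≡0) ⟩
    A / b + v / b    ≡⟨ cong (A / b +_) (m<n⇒m/n≡0 v<b) ⟩
    A / b + 0        ≡⟨ +-identityʳ (A / b) ⟩
    A / b            ∎)
    where open ≡-Reasoning
  digit-add-there zero (suc f) A v _ _ _ =
    trans (cong (λ t → (A + t) % b) (pow-suc v f)) ([m+kn]%n≡m%n A (v * b ^ f) b)
  digit-add-there (suc e) (suc f) A v e≢f A₀≡0 v<b =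
    trans (cong (digit e) (/-shift A v f)) (digit-add-there e f (A / b) v (λ e≡f → e≢f (cong suc e≡f)) A₀≡0 v<b)

  digit-ext : 2 ≤ b → ∀ M M' → (∀ e → digit e M ≡ digit e M') → M ≡ M'
  digit-ext b≥2 M M' same = bounded (M + M') M M' (m≤m+n M M') (m≤n+m M' M) same
    where
    /b-≤ : ∀ F M → M ≤ suc F → M / b ≤ F
    /b-≤ F zero _ = subst (_≤ F) (sym (0/n≡0 b)) z≤n
    /b-≤ F (suc M) M≤F+1 = ≤-pred (≤-trans (m/n<m (suc M) b b≥2) M≤F+1)
    bounded : ∀ F M M' → M ≤ F → M' ≤ F → (∀ e → digit e M ≡ digit e M') → M ≡ M'
    bounded zero zero zero _ _ _ = refl
    bounded (suc F) M M' M≤ M'≤ same = begin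
      M                      ≡⟨ m≡m%n+[m/n]*n M b ⟩
      M % b + (M / b) * b    ≡⟨ cong₂ (λ r q → r + q * b) (same 0) quotients-equal ⟩
      M' % b + (M' / b) * b  ≡⟨ sym (m≡m%n+[m/n]*n M' b) ⟩
      M'                     ∎
      where
      open ≡-Reasoning
      quotients-equal : M / b ≡ M' / b
      quotients-equal = bounded F (M / b) (M' / b) (/b-≤ F M M≤) (/b-≤ F M' M'≤) (same ∘ suc)

-- Splitting off the largest power of b: k = b ^ ν k * core k

module Valuation (b : ℕ) .{{_ : NonZero b}} where

  -- a factor b can be split off (for b = 1 we never split, so that core k = k)
  Splittable : ℕ → Set
  Splittable k = 2 ≤ b × b ∣ k × k ≢ 0

  splittable? : ∀ k → Dec (Splittable k)
  splittable? k = (2 ≤? b) ×-dec ((b ∣? k) ×-dec (¬? (k ≟ 0)))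

  divideOut : ℕ → ℕ → ℕ × ℕ
  divideOut zero k = 0 , k
  divideOut (suc fuel) k with splittable? k
  ... | yes _ = suc (proj₁ (divideOut fuel (k / b))) , proj₂ (divideOut fuel (k / b))
  ... | no _ = 0 , k

  divideOut-correct : ∀ fuel k → k ≡ b ^ proj₁ (divideOut fuel k) * proj₂ (divideOut fuel k)
  divideOut-correct zero k = sym (*-identityˡ k)
  divideOut-correct (suc fuel) k with splittable? k
  ... | no _ = sym (*-identityˡ k)
  ... | yes (_ , b∣k , _) = begin
    k                  ≡⟨ sym (m/n*n≡m b∣k) ⟩
    (k / b) * b        ≡⟨ cong (_* b) (divideOut-correct fuel (k / b)) ⟩
    (b ^ e * q) * b    ≡⟨ rotate b (b ^ e) q ⟩
    b * b ^ e * q      ∎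
    where
    open ≡-Reasoning
    e = proj₁ (divideOut fuel (k / b))
    q = proj₂ (divideOut fuel (k / b))
    rotate : ∀ b x y → (x * y) * b ≡ b * x * y
    rotate = solve-∀

  divideOut-maximal : 2 ≤ b → ∀ fuel k → k ≢ 0 → k ≤ fuel → ¬ (b ∣ proj₂ (divideOut fuel k))
  divideOut-maximal b≥2 zero zero k≢0 _ = ⊥-elim (k≢0 refl)
  divideOut-maximal b≥2 (suc fuel) k k≢0 k≤fuel+1 with splittable? k
  ... | no ¬splittable = λ b∣k → ¬splittable (b≥2 , b∣k , k≢0)
  ... | yes (_ , b∣k , _) = divideOut-maximal b≥2 fuel (k / b) k/b≢0 k/b≤fuel
    where
    k/b≢0 : k / b ≢ 0
    k/b≢0 k/b≡0 = k≢0 (trans (sym (m/n*n≡m b∣k)) (cong (_* b) k/b≡0))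
    k/b≤fuel : k / b ≤ fuel
    k/b≤fuel = ≤-pred (≤-trans (m/n<m k b {{≢-nonZero k≢0}} b≥2) k≤fuel+1)

  ν : ℕ → ℕ
  ν k = proj₁ (divideOut k k)

  core : ℕ → ℕ
  core k = proj₂ (divideOut k k)

  ν-core : ∀ k → k ≡ b ^ ν k * core k
  ν-core k = divideOut-correct k k

  core-indivisible : 2 ≤ b → ∀ k → k ≢ 0 → ¬ (b ∣ core k)
  core-indivisible b≥2 k k≢0 = divideOut-maximal b≥2 k k k≢0 ≤-refl

  core≤ : ∀ k → core k ≤ k
  core≤ k = subst (core k ≤_) (sym (ν-core k)) (m≤n*m (core k) (b ^ ν k) {{m^n≢0 b (ν k)}})

  core≢0 : ∀ k → k ≢ 0 → core k ≢ 0
  core≢0 k k≢0 core≡0 = k≢0 (trans (ν-core k) (trans (cong (b ^ ν k *_) core≡0) (*-zeroʳ (b ^ ν k))))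

  power-unique : ∀ e e' q q' → ¬ (b ∣ q) → ¬ (b ∣ q') → b ^ e * q ≡ b ^ e' * q' → e ≡ e' × q ≡ q'
  power-unique zero zero q q' _ _ eq = refl , trans (sym (*-identityˡ q)) (trans eq (*-identityˡ q'))
  power-unique zero (suc e') q q' b∤q _ eq =
    ⊥-elim (b∤q (divides (b ^ e' * q') (trans (sym (*-identityˡ q)) (trans eq (rotate b (b ^ e') q')))))
    where
    rotate : ∀ b x y → b * x * y ≡ x * y * b
    rotate = solve-∀
  power-unique (suc e) zero q q' b∤q b∤q' eq with power-unique zero (suc e) q' q b∤q' b∤q (sym eq)
  ... | () , _
  power-unique (suc e) (suc e') q q' b∤q b∤q' eq
    with power-unique e e' q q' b∤q b∤q'
           (*-cancelˡ-≡ (b ^ e * q) (b ^ e' * q') b (trans (sym (*-assoc b (b ^ e) q)) (trans eq (*-assoc b (b ^ e') q'))))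
  ... | refl , q≡q' = refl , q≡q'

  ν-core-power : 2 ≤ b → ∀ e q → ¬ (b ∣ q) → ν (b ^ e * q) ≡ e × core (b ^ e * q) ≡ q
  ν-core-power b≥2 e q b∤q = power-unique _ _ _ _ (core-indivisible b≥2 k k≢0) b∤q (sym (ν-core k))
    where
    k = b ^ e * q
    k≢0 : k ≢ 0
    k≢0 k≡0 with m*n≡0⇒m≡0∨n≡0 (b ^ e) k≡0
    ... | inj₁ b^e≡0 = ≢-nonZero⁻¹ (b ^ e) {{m^n≢0 b e}} b^e≡0
    ... | inj₂ refl = b∤q (divides 0 refl)

-- The canonical representation m = a₁ · cx m + a₂ · cy m with cy m < b of elements of S.
-- Here b = a₁ / gcd(a₁, a₂), characterised by:  a₁ ∣ a₂ t  iff  b ∣ t.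

module Canonical (a₁ a₂ b : ℕ) .{{_ : NonZero a₁}} .{{_ : NonZero b}}
                 (a₁∣a₂t⇒b∣t : ∀ t → a₁ ∣ a₂ * t → b ∣ t)
                 (b∣t⇒a₁∣a₂t : ∀ t → b ∣ t → a₁ ∣ a₂ * t) where

  -- Y is admissible for m when m = a₁ X + a₂ Y for some X
  Admissible : ℕ → ℕ → Set
  Admissible m Y = a₂ * Y ≤ m × a₁ ∣ m ∸ a₂ * Y

  admissible? : ∀ m Y → Dec (Admissible m Y)
  admissible? m Y = (a₂ * Y ≤? m) ×-dec (a₁ ∣? (m ∸ a₂ * Y))

  search : ℕ → ℕ → ℕ → ℕ
  search m s zero = 0
  search m s (suc f) with admissible? m s
  ... | yes _ = s
  ... | no _ = search m (suc s) f

  cy : ℕ → ℕ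
  cy m = search m 0 b

  cx : ℕ → ℕ
  cx m = (m ∸ a₂ * cy m) / a₁

  search-range : ∀ m s f → search m s f ≡ 0 ⊎ search m s f < s + f
  search-range m s zero = inj₁ refl
  search-range m s (suc f) with admissible? m s
  ... | yes _ = inj₂ (m<m+n s (s≤s z≤n))
  ... | no _ = ⊎-map₂ (λ lt → ≤-trans lt (≤-reflexive (sym (+-suc s f)))) (search-range m (suc s) f)

  cy<b : ∀ m → cy m < b
  cy<b m with search-range m 0 b
  ... | inj₁ cy≡0 = subst (_< b) (sym cy≡0) (>-nonZero⁻¹ b)
  ... | inj₂ cy<b = cy<b

  -- two admissible values below b coincide: their difference t satisfies a₁ ∣ a₂ t, hence b ∣ t
  admissible-ordered : ∀ {m Y Y'} → Admissible m Y → Admissible m Y' → Y' < b → Y ≤ Y' → Y ≡ Y'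
  admissible-ordered {m} {Y} {Y'} (_ , a₁∣m-a₂Y) (a₂Y'≤m , a₁∣m-a₂Y') Y'<b Y≤Y' =
    sym (≤-antisym (m∸n≡0⇒m≤n Y'-Y≡0) Y≤Y')
    where
    split-diff : m ∸ a₂ * Y ≡ (m ∸ a₂ * Y') + a₂ * (Y' ∸ Y)
    split-diff = begin
      m ∸ a₂ * Y                              ≡⟨ cong (_∸ a₂ * Y) (sym (m∸n+n≡m a₂Y'≤m)) ⟩
      (m ∸ a₂ * Y') + a₂ * Y' ∸ a₂ * Y        ≡⟨ +-∸-assoc (m ∸ a₂ * Y') (*-monoʳ-≤ a₂ Y≤Y') ⟩
      (m ∸ a₂ * Y') + (a₂ * Y' ∸ a₂ * Y)      ≡⟨ cong ((m ∸ a₂ * Y') +_) (sym (*-distribˡ-∸ a₂ Y' Y)) ⟩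
      (m ∸ a₂ * Y') + a₂ * (Y' ∸ Y)           ∎
      where open ≡-Reasoning
    b∣Y'-Y : b ∣ Y' ∸ Y
    b∣Y'-Y = a₁∣a₂t⇒b∣t (Y' ∸ Y) (∣m+n∣m⇒∣n (subst (a₁ ∣_) split-diff a₁∣m-a₂Y) a₁∣m-a₂Y')
    Y'-Y≡0 : Y' ∸ Y ≡ 0
    Y'-Y≡0 with Y' ∸ Y in eq
    ... | zero = refl
    ... | suc t = ⊥-elim (<⇒≱ (≤-<-trans (subst (_≤ Y') eq (m∸n≤m Y' Y)) Y'<b) (∣⇒≤ (subst (b ∣_) eq b∣Y'-Y)))

  admissible-unique : ∀ {m Y Y'} → Admissible m Y → Admissible m Y' → Y < b → Y' < b → Y ≡ Y'
  admissible-unique {Y = Y} {Y'} adm adm' Y<b Y'<b with ≤-total Y Y'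
  ... | inj₁ Y≤Y' = admissible-ordered adm adm' Y'<b Y≤Y'
  ... | inj₂ Y'≤Y = sym (admissible-ordered adm' adm Y<b Y'≤Y)

  search-finds : ∀ m s f Y → s ≤ Y → Y < s + f → Admissible m Y →
                 (∀ Y' → s ≤ Y' → Y' < s + f → Admissible m Y' → Y' ≡ Y) → search m s f ≡ Y
  search-finds m s zero Y s≤Y Y<s+0 _ _ = ⊥-elim (<⇒≱ Y<s+0 (subst (_≤ Y) (sym (+-identityʳ s)) s≤Y))
  search-finds m s (suc f) Y s≤Y Y<s+f+1 adm unique with admissible? m s
  ... | yes adm-s = unique s ≤-refl (m<m+n s (s≤s z≤n)) adm-s
  ... | no ¬adm-s =
    search-finds m (suc s) f Y (≤∧≢⇒< s≤Y (λ { refl → ¬adm-s adm })) (subst (Y <_) (+-suc s f) Y<s+f+1) adm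
      (λ Y' s<Y' Y'<s+f → unique Y' (<⇒≤ s<Y') (subst (Y' <_) (sym (+-suc s f)) Y'<s+f))

  cy-unique : ∀ m Y → Y < b → Admissible m Y → cy m ≡ Y
  cy-unique m Y Y<b adm = search-finds m 0 b Y z≤n Y<b adm (λ Y' _ Y'<b adm' → admissible-unique adm' adm Y'<b Y<b)

  -- an element x₁ a₁ + x₂ a₂ of S has the admissible value x₂ mod b, since a₁ ∣ a₂ · (x₂ - x₂ mod b)
  cy-admissible : ∀ m → InS a₁ a₂ m → Admissible m (cy m)
  cy-admissible m (x₁ , x₂ , eq) = subst (Admissible m) (sym (cy-unique m r (m%n<n x₂ b) adm-r)) adm-r
    where
    r = x₂ % b
    q = x₂ / b
    m≡ : m ≡ (x₁ * a₁ + a₂ * (q * b)) + a₂ * r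
    m≡ = trans (sym eq) (trans (cong (λ t → x₁ * a₁ + t * a₂) (m≡m%n+[m/n]*n x₂ b)) (regroup x₁ a₁ a₂ r q b))
      where
      regroup : ∀ x₁ a₁ a₂ r q b → x₁ * a₁ + (r + q * b) * a₂ ≡ (x₁ * a₁ + a₂ * (q * b)) + a₂ * r
      regroup = solve-∀
    adm-r : Admissible m r
    adm-r = subst (a₂ * r ≤_) (sym m≡) (m≤n+m _ _) ,
            subst (a₁ ∣_) (sym (trans (cong (_∸ a₂ * r) m≡) (m+n∸n≡m _ (a₂ * r))))
              (∣m∣n⇒∣m+n (n∣m*n x₁) (b∣t⇒a₁∣a₂t (q * b) (n∣m*n q)))

  canonical : ∀ m → InS a₁ a₂ m → m ≡ a₁ * cx m + a₂ * cy m
  canonical m m∈S with cy-admissible m m∈S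
  ... | a₂cy≤m , a₁∣rest = begin
    m                            ≡⟨ sym (m∸n+n≡m a₂cy≤m) ⟩
    (m ∸ a₂ * cy m) + a₂ * cy m  ≡⟨ cong (_+ a₂ * cy m) (sym (m/n*n≡m a₁∣rest)) ⟩
    cx m * a₁ + a₂ * cy m        ≡⟨ cong (_+ a₂ * cy m) (*-comm (cx m) a₁) ⟩
    a₁ * cx m + a₂ * cy m        ∎
    where open ≡-Reasoning

  cy-canonical : ∀ X Y → Y < b → cy (a₁ * X + a₂ * Y) ≡ Y
  cy-canonical X Y Y<b =
    cy-unique _ Y Y<b (m≤n+m _ _ , subst (a₁ ∣_) (sym (m+n∸n≡m (a₁ * X) (a₂ * Y))) (m∣m*n X))

  cx-canonical : ∀ X Y → Y < b → cx (a₁ * X + a₂ * Y) ≡ X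
  cx-canonical X Y Y<b = begin
    (a₁ * X + a₂ * Y ∸ a₂ * cy (a₁ * X + a₂ * Y)) / a₁
      ≡⟨ cong (λ t → (a₁ * X + a₂ * Y ∸ a₂ * t) / a₁) (cy-canonical X Y Y<b) ⟩
    (a₁ * X + a₂ * Y ∸ a₂ * Y) / a₁
      ≡⟨ cong (_/ a₁) (trans (m+n∸n≡m (a₁ * X) (a₂ * Y)) (*-comm a₁ X)) ⟩
    (X * a₁) / a₁
      ≡⟨ m*n/n≡m X a₁ ⟩
    X
      ∎
    where open ≡-Reasoning

-- (ii) ↔ (iii): a Glaisher-type bijection.
-- A part k of multiplicity v = a₁ · cx v + a₂ · cy v (with cy v < b) is replaced by cx v copies
-- of k a₁ and cy v · b ^ ν k copies of core k · a₂.  Conversely the multiplicity of k is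
-- recovered from the multiplicity of k a₁ and the (ν k)-th base-b digit of that of core k · a₂.

module Glaisher (n a₁ a₂ b : ℕ) .{{_ : NonZero a₁}} .{{_ : NonZero a₂}} .{{_ : NonZero b}}
                (a₁∣a₂t⇒b∣t : ∀ t → a₁ ∣ a₂ * t → b ∣ t)
                (b∣t⇒a₁∣a₂t : ∀ t → b ∣ t → a₁ ∣ a₂ * t) where

  open Canonical a₁ a₂ b a₁∣a₂t⇒b∣t b∣t⇒a₁∣a₂t
  open Digits b
  open Valuation b

  -- the multiplicity of the part j produced by a part k of multiplicity v
  contribution : ℕ → ℕ → ℕ → ℕ
  contribution k v j = point (k * a₁) (cx v) j + point (core k * a₂) (cy v * b ^ ν k) j

  spread : ℕ → (ℕ → ℕ) → ℕ → ℕ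
  spread L m j = sumTo L (λ k → contribution k (m k) j)

  gather : (ℕ → ℕ) → ℕ → ℕ
  gather e k = a₁ * e (k * a₁) + a₂ * digit (ν k) (e (core k * a₂))

  spread-cong : ∀ L {m m'} j → (∀ k → InRange L k → m k ≡ m' k) → spread L m j ≡ spread L m' j
  spread-cong L j m≗m' = sumTo-cong L (λ k r → cong (λ v → contribution k v j) (m≗m' k r))

  gather-InS : ∀ e k → InS a₁ a₂ (gather e k)
  gather-InS e k = e (k * a₁) , digit (ν k) (e (core k * a₂)) , cong₂ _+_ (*-comm _ a₁) (*-comm _ a₂)

  gather-cong : ∀ {e e'} k → (∀ j → e j ≡ e' j) → gather e k ≡ gather e' k
  gather-cong k e≗e' = cong₂ (λ x y → a₁ * x + a₂ * digit (ν k) y) (e≗e' (k * a₁)) (e≗e' (core k * a₂))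

  private
    one-or-more : ∀ c .{{_ : NonZero c}} → c ≡ 1 ⊎ 2 ≤ c
    one-or-more (suc zero) = inj₁ refl
    one-or-more (suc (suc _)) = inj₂ (s≤s (s≤s z≤n))

    b≡1⊎b≥2 : b ≡ 1 ⊎ 2 ≤ b
    b≡1⊎b≥2 = one-or-more b

    <1⇒≡0 : ∀ {x} → b ≡ 1 → x < b → x ≡ 0
    <1⇒≡0 refl x<1 = n<1⇒n≡0 x<1

    k≢0 : ∀ {L k} → InRange L k → k ≢ 0
    k≢0 (1≤k , _) refl = <⇒≱ 1≤k z≤n

    a₁∤ : ∀ {q} → ¬ (b ∣ q) → ¬ (a₁ ∣ q * a₂)
    a₁∤ {q} b∤q a₁∣ = b∤q (a₁∣a₂t⇒b∣t q (subst (a₁ ∣_) (*-comm q a₂) a₁∣))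

    b≥2-of : ∀ {q} → ¬ (b ∣ q) → 2 ≤ b
    b≥2-of {q} b∤q with b≡1⊎b≥2
    ... | inj₁ b≡1 = ⊥-elim (b∤q (subst (_∣ q) (sym b≡1) (1∣ q)))
    ... | inj₂ b≥2 = b≥2

    first-of : ∀ {A B : Set} → A ⊎ B → ¬ B → A
    first-of (inj₁ a) _ = a
    first-of (inj₂ b) ¬b = ⊥-elim (¬b b)

    positive-product : ∀ {x y} → x ≢ 0 → 1 ≤ y → 1 ≤ x * y
    positive-product {suc x} _ 1≤y = ≤-trans 1≤y (m≤m+n _ _)
    positive-product {zero} x≢0 _ = ⊥-elim (x≢0 refl)

    ka₁-positive : ∀ {k} → k ≢ 0 → 1 ≤ k * a₁
    ka₁-positive k≢0 = positive-product k≢0 (>-nonZero⁻¹ a₁)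

    core-a₂-positive : ∀ {k} → k ≢ 0 → 1 ≤ core k * a₂
    core-a₂-positive {k} k≢0 = positive-product (core≢0 k k≢0) (>-nonZero⁻¹ a₂)

  spread-divisible : ∀ L m j → spread L m j ≢ 0 → a₁ ∣ j ⊎ a₂ ∣ j
  spread-divisible L m j spread≢0 with a₁ ∣? j | a₂ ∣? j
  ... | yes a₁∣j | _ = inj₁ a₁∣j
  ... | no _ | yes a₂∣j = inj₂ a₂∣j
  ... | no a₁∤j | no a₂∤j = ⊥-elim (spread≢0 (trans (sumTo-cong L (λ k _ → nothing k)) (sumTo-zero L)))
    where
    nothing : ∀ k → contribution k (m k) j ≡ 0
    nothing k =
      cong₂ _+_ (point-there _ (λ j≡ → a₁∤j (divides k j≡))) (point-there _ (λ j≡ → a₂∤j (divides (core k) j≡)))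

  spread-a₁ : ∀ L m k → spread L m (k * a₁) ≡ restrict L (λ j → cx (m j)) k
  spread-a₁ L m k = begin
    spread L m (k * a₁)                   ≡⟨ sumTo-cong L only-k ⟩
    sumTo L (point k (cx (m k)))          ≡⟨ sumTo-point L k (cx (m k)) ⟩
    restrict L (λ _ → cx (m k)) k         ≡⟨ restrict-cong L k (λ _ → refl) ⟩
    restrict L (λ j → cx (m j)) k         ∎
    where
    open ≡-Reasoning
    second-vanishes : ∀ k' → InRange L k' → point (core k' * a₂) (cy (m k') * b ^ ν k') (k * a₁) ≡ 0
    second-vanishes k' r with b≡1⊎b≥2
    ... | inj₁ b≡1 = trans (cong (λ c → point (core k' * a₂) (c * b ^ ν k') (k * a₁)) (<1⇒≡0 b≡1 (cy<b (m k'))))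
                           (point-zero _ _)
    ... | inj₂ b≥2 = point-there _ (λ k₁≡ → a₁∤ (core-indivisible b≥2 k' (k≢0 r)) (divides k (sym k₁≡)))
    first-term : ∀ k' → point (k' * a₁) (cx (m k')) (k * a₁) ≡ point k (cx (m k)) k'
    first-term k' = by-cases (k' ≟ k)
      where
      by-cases : Dec (k' ≡ k) → point (k' * a₁) (cx (m k')) (k * a₁) ≡ point k (cx (m k)) k'
      by-cases (yes refl) = trans (point-here (k * a₁) (cx (m k))) (sym (point-here k (cx (m k))))
      by-cases (no k'≢k) = trans (point-there _ (λ eq → k'≢k (sym (*-cancelʳ-≡ k k' a₁ eq)))) (sym (point-there _ k'≢k))
    only-k : ∀ k' → InRange L k' → contribution k' (m k') (k * a₁) ≡ point k (cx (m k)) k'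
    only-k k' r = trans (cong₂ _+_ (first-term k') (second-vanishes k' r)) (+-identityʳ _)

  contribution-a₂ : ∀ {q} k v → ¬ (b ∣ q) → contribution k v (q * a₂) ≡ point (core k) (cy v * b ^ ν k) q
  contribution-a₂ {q} k v b∤q =
    cong₂ _+_ (point-there _ (λ qa₂≡ → a₁∤ b∤q (divides k qa₂≡))) (by-cases (q ≟ core k))
    where
    by-cases : Dec (q ≡ core k) → point (core k * a₂) (cy v * b ^ ν k) (q * a₂) ≡ point (core k) (cy v * b ^ ν k) q
    by-cases (yes refl) = trans (point-here (q * a₂) _) (sym (point-here q _))
    by-cases (no q≢core) = trans (point-there _ (q≢core ∘ *-cancelʳ-≡ q (core k) a₂)) (sym (point-there _ q≢core))

  spread-a₂ : ∀ L m q → ¬ (b ∣ q) → ∀ e → digit e (spread L m (q * a₂)) ≡ restrict L (λ j → cy (m j)) (b ^ e * q)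
  spread-a₂ zero m q b∤q e = trans (digit-zero e) (sym (restrict-zero _ (b ^ e * q)))
  spread-a₂ (suc L) m q b∤q e = begin
    digit e (contribution k (m k) (q * a₂) + A)  ≡⟨ cong (λ t → digit e (t + A)) (contribution-a₂ k (m k) b∤q) ⟩
    digit e (point (core k) v q + A)             ≡⟨ by-cases (q ≟ core k) ⟩
    restrict k (λ j → cy (m j)) (b ^ e * q)      ∎
    where
    open ≡-Reasoning
    k = suc L
    A = spread L m (q * a₂)
    v = cy (m k) * b ^ ν k
    new-index : b ^ e * q ≡ k → e ≡ ν k × q ≡ core k
    new-index eq = power-unique e (ν k) q (core k) b∤q (core-indivisible (b≥2-of b∤q) k (λ ())) (trans eq (ν-core k))
    by-cases : Dec (q ≡ core k) → digit e (point (core k) v q + A) ≡ restrict k (λ j → cy (m j)) (b ^ e * q)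
    by-cases (no q≢core) = begin
      digit e (point (core k) v q + A)           ≡⟨ cong (λ t → digit e (t + A)) (point-there v q≢core) ⟩
      digit e A                                  ≡⟨ spread-a₂ L m q b∤q e ⟩
      restrict L (λ j → cy (m j)) (b ^ e * q)    ≡⟨ restrict-suc L _ _ (q≢core ∘ proj₂ ∘ new-index) ⟩
      restrict k (λ j → cy (m j)) (b ^ e * q)    ∎
    by-cases (yes refl) = begin
      digit e (point q v q + A)                  ≡⟨ cong (λ t → digit e (t + A)) (point-here q v) ⟩
      digit e (v + A)                            ≡⟨ cong (digit e) (+-comm v A) ⟩
      digit e (A + v)                            ≡⟨ by-digit (e ≟ ν k) ⟩
      restrict k (λ j → cy (m j)) (b ^ e * q)    ∎
      where
      -- the place ν k of A is still empty
      empty : digit (ν k) A ≡ 0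
      empty = trans (spread-a₂ L m q b∤q (ν k)) (trans (cong (restrict L _) (sym (ν-core k))) (restrict-beyond L _))
      by-digit : Dec (e ≡ ν k) → digit e (A + v) ≡ restrict k (λ j → cy (m j)) (b ^ e * q)
      by-digit (yes refl) = begin
        digit e (A + cy (m k) * b ^ e)           ≡⟨ digit-add-here e A (cy (m k)) empty (cy<b (m k)) ⟩
        cy (m k)                                 ≡⟨ sym (restrict-top L _) ⟩
        restrict k (λ j → cy (m j)) k            ≡⟨ cong (restrict k _) (ν-core k) ⟩
        restrict k (λ j → cy (m j)) (b ^ e * q)  ∎
      by-digit (no e≢ν) = begin
        digit e (A + v)                          ≡⟨ digit-add-there e (ν k) A (cy (m k)) e≢ν empty (cy<b (m k)) ⟩
        digit e A                                ≡⟨ spread-a₂ L m q b∤q e ⟩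
        restrict L (λ j → cy (m j)) (b ^ e * q)  ≡⟨ restrict-suc L _ _ (e≢ν ∘ proj₁ ∘ new-index) ⟩
        restrict k (λ j → cy (m j)) (b ^ e * q)  ∎

  -- v is canonically represented, and the parts k a₁ and core k · a₂ it produces are at most N
  Fits : ℕ → ℕ → ℕ → Set
  Fits N k v = (v ≡ a₁ * cx v + a₂ * cy v) × (cx v ≡ 0 ⊎ k * a₁ ≤ N) × (cy v ≡ 0 ⊎ core k * a₂ ≤ N)

  fits? : ∀ N k v → Dec (Fits N k v)
  fits? N k v = (v ≟ _) ×-dec (((cx v ≟ 0) ⊎-dec (k * a₁ ≤? N)) ×-dec ((cy v ≟ 0) ⊎-dec (core k * a₂ ≤? N)))

  fits-of-InS : ∀ N k v → InS a₁ a₂ v → k * v ≤ N → Fits N k v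
  fits-of-InS N k v v∈S kv≤N = v≡ , fits-x , fits-y
    where
    v≡ = canonical v v∈S
    kv-≥ : ∀ {x} → x ≤ v → k * x ≤ N
    kv-≥ x≤v = ≤-trans (*-monoʳ-≤ k x≤v) kv≤N
    fits-x : cx v ≡ 0 ⊎ k * a₁ ≤ N
    fits-x with cx v ≟ 0
    ... | yes cx≡0 = inj₁ cx≡0
    ... | no cx≢0 = inj₂ (kv-≥ (subst (a₁ ≤_) (sym v≡) (≤-trans (m≤m*n a₁ (cx v) {{≢-nonZero cx≢0}}) (m≤m+n _ _))))
    fits-y : cy v ≡ 0 ⊎ core k * a₂ ≤ N
    fits-y with cy v ≟ 0
    ... | yes cy≡0 = inj₁ cy≡0
    ... | no cy≢0 = inj₂ (≤-trans (*-monoˡ-≤ a₂ (core≤ k))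
                    (kv-≥ (subst (a₂ ≤_) (sym v≡) (≤-trans (m≤m*n a₂ (cy v) {{≢-nonZero cy≢0}}) (m≤n+m _ _)))))

  weight-contribution : ∀ N k v → k ≢ 0 → Fits N k v → weight (contribution k v) N ≡ k * v
  weight-contribution N k v k≢0 (v≡ , fits-x , fits-y) = begin
    weight (contribution k v) N
      ≡⟨ weight-+ N _ _ ⟩
    weight (point (k * a₁) (cx v)) N + weight (point (core k * a₂) (cy v * b ^ ν k)) N
      ≡⟨ cong₂ _+_ (weight-point N _ _ x-copies) (weight-point N _ _ y-copies) ⟩
    k * a₁ * cx v + core k * a₂ * (cy v * b ^ ν k)
      ≡⟨ cong (λ t → t * a₁ * cx v + core k * a₂ * (cy v * b ^ ν k)) (ν-core k) ⟩
    b ^ ν k * core k * a₁ * cx v + core k * a₂ * (cy v * b ^ ν k)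
      ≡⟨ factor (b ^ ν k) (core k) a₁ a₂ (cx v) (cy v) ⟩
    (b ^ ν k * core k) * (a₁ * cx v + a₂ * cy v)
      ≡⟨ cong₂ _*_ (sym (ν-core k)) (sym v≡) ⟩
    k * v
      ∎
    where
    open ≡-Reasoning
    x-copies : InRange N (k * a₁) ⊎ cx v ≡ 0
    x-copies = ⊎-map (ka₁-positive k≢0 ,_) id (swap fits-x)
    y-copies : InRange N (core k * a₂) ⊎ cy v * b ^ ν k ≡ 0
    y-copies = ⊎-map (core-a₂-positive k≢0 ,_) (cong (_* b ^ ν k)) (swap fits-y)
    factor : ∀ B c a₁ a₂ X Y → B * c * a₁ * X + c * a₂ * (Y * B) ≡ (B * c) * (a₁ * X + a₂ * Y)
    factor = solve-∀

  weight-spread : ∀ L N m → (∀ k → InRange L k → Fits N k (m k)) → weight (spread L m) N ≡ weight m L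
  weight-spread zero N m _ = trans (sumTo-cong N (λ j _ → *-zeroʳ j)) (sumTo-zero N)
  weight-spread (suc L) N m fits = begin
    weight (λ j → contribution (suc L) (m (suc L)) j + spread L m j) N
      ≡⟨ weight-+ N _ _ ⟩
    weight (contribution (suc L) (m (suc L))) N + weight (spread L m) N
      ≡⟨ cong₂ _+_ (weight-contribution N (suc L) (m (suc L)) (λ ()) (fits (suc L) (inRange-top L)))
                   (weight-spread L N m (λ k r → fits k (inRange-suc r))) ⟩
    suc L * m (suc L) + weight m L
      ∎
    where open ≡-Reasoning

  gather-spread : ∀ m → (∀ k → InRange n k → Fits n k (m k)) →
                  ∀ k → InRange n k → gather (restrict n (spread n m)) k ≡ m k
  gather-spread m fits k r = begin
    a₁ * restrict n (spread n m) (k * a₁) + a₂ * digit (ν k) (restrict n (spread n m) (core k * a₂))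
      ≡⟨ cong₂ (λ x y → a₁ * x + a₂ * y) (x-part (k * a₁ ≤? n)) y-part ⟩
    a₁ * cx (m k) + a₂ * cy (m k)
      ≡⟨ sym (proj₁ (fits k r)) ⟩
    m k
      ∎
    where
    open ≡-Reasoning
    m' = restrict n (spread n m)
    x-part : Dec (k * a₁ ≤ n) → m' (k * a₁) ≡ cx (m k)
    x-part (yes ka₁≤n) = begin
      m' (k * a₁)                   ≡⟨ restrict-in _ _ (ka₁-positive (k≢0 r) , ka₁≤n) ⟩
      spread n m (k * a₁)           ≡⟨ spread-a₁ n m k ⟩
      restrict n (λ j → cx (m j)) k ≡⟨ restrict-in _ k r ⟩
      cx (m k)                      ∎
    x-part (no ka₁≰n) = trans (restrict-out _ _ (ka₁≰n ∘ proj₂))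
                              (sym (first-of (proj₁ (proj₂ (fits k r))) ka₁≰n))
    y-part : digit (ν k) (m' (core k * a₂)) ≡ cy (m k)
    y-part with b≡1⊎b≥2
    ... | inj₁ b≡1 = trans (<1⇒≡0 b≡1 (digit<b (ν k) _)) (sym (<1⇒≡0 b≡1 (cy<b (m k))))
    ... | inj₂ b≥2 = by-size (core k * a₂ ≤? n)
      where
      by-size : Dec (core k * a₂ ≤ n) → digit (ν k) (m' (core k * a₂)) ≡ cy (m k)
      by-size (yes ≤n) = begin
        digit (ν k) (m' (core k * a₂))
          ≡⟨ cong (digit (ν k)) (restrict-in _ _ (core-a₂-positive (k≢0 r) , ≤n)) ⟩
        digit (ν k) (spread n m (core k * a₂))
          ≡⟨ spread-a₂ n m (core k) (core-indivisible b≥2 k (k≢0 r)) (ν k) ⟩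
        restrict n (λ j → cy (m j)) (b ^ ν k * core k)
          ≡⟨ cong (restrict n _) (sym (ν-core k)) ⟩
        restrict n (λ j → cy (m j)) k
          ≡⟨ restrict-in _ k r ⟩
        cy (m k)
          ∎
      by-size (no ≰n) = trans (cong (digit (ν k)) (restrict-out _ _ (≰n ∘ proj₂)))
        (trans (digit-zero (ν k)) (sym (first-of (proj₂ (proj₂ (fits k r))) ≰n)))

  spread-gather-a₁ : ∀ e k → InRange n k → spread n (gather e) (k * a₁) ≡ e (k * a₁)
  spread-gather-a₁ e k r = begin
    spread n (gather e) (k * a₁)            ≡⟨ spread-a₁ n (gather e) k ⟩
    restrict n (λ i → cx (gather e i)) k    ≡⟨ restrict-in _ k r ⟩
    cx (gather e k)                         ≡⟨ cx-canonical _ _ (digit<b (ν k) _) ⟩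
    e (k * a₁)                              ∎
    where open ≡-Reasoning

  spread-gather-a₂ : ∀ e → (∀ j → j * e j ≤ n) → ∀ q → ¬ (b ∣ q) → spread n (gather e) (q * a₂) ≡ e (q * a₂)
  spread-gather-a₂ e bounded q b∤q =
    digit-ext b≥2 _ _ λ d → trans (spread-a₂ n (gather e) q b∤q d) (by-range d (inRange? n (b ^ d * q)))
    where
    b≥2 : 2 ≤ b
    b≥2 = b≥2-of b∤q
    E = e (q * a₂)
    by-range : ∀ d → Dec (InRange n (b ^ d * q)) → restrict n (λ i → cy (gather e i)) (b ^ d * q) ≡ digit d E
    by-range d (yes r) = begin
      restrict n (λ i → cy (gather e i)) k       ≡⟨ restrict-in _ k r ⟩
      cy (gather e k)                            ≡⟨ cy-canonical _ _ (digit<b (ν k) _) ⟩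
      digit (ν k) (e (core k * a₂))              ≡⟨ cong₂ (λ x y → digit x (e (y * a₂))) ν≡d core≡q ⟩
      digit d E                                  ∎
      where
      open ≡-Reasoning
      k = b ^ d * q
      ν≡d : ν k ≡ d
      ν≡d = proj₁ (ν-core-power b≥2 d q b∤q)
      core≡q : core k ≡ q
      core≡q = proj₂ (ν-core-power b≥2 d q b∤q)
    -- if b ^ d q exceeds n, then E < b ^ d because q a₂ · E ≤ n
    by-range d (no ¬r) = trans (restrict-out _ (b ^ d * q) ¬r) (sym (digit-small d E E<b^d))
      where
      q≢0 : q ≢ 0
      q≢0 refl = b∤q (divides 0 refl)
      1≤b^dq : 1 ≤ b ^ d * q
      1≤b^dq = positive-product (≢-nonZero⁻¹ (b ^ d) {{m^n≢0 b d}}) (n≢0⇒n>0 q≢0)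
      E<b^d : E < b ^ d
      E<b^d with b ^ d ≤? E
      ... | no b^d≰E = ≰⇒> b^d≰E
      ... | yes b^d≤E = ⊥-elim (¬r (1≤b^dq , ≤-trans (*-monoˡ-≤ q b^d≤E)
              (≤-trans (*-monoʳ-≤ E (m≤m*n q a₂)) (≤-trans (≤-reflexive (*-comm E (q * a₂))) (bounded (q * a₂))))))

  spread-gather : ∀ e → (∀ j → ¬ (a₁ ∣ j) → ¬ (a₂ ∣ j) → e j ≡ 0) → (∀ j → j * e j ≤ n) →
                  ∀ j → InRange n j → spread n (gather e) j ≡ e j
  spread-gather e divisible bounded j (1≤j , j≤n) with a₁ ∣? j | a₂ ∣? j
  ... | yes (divides k refl) | _ =
    spread-gather-a₁ e k (n≢0⇒n>0 (λ { refl → <⇒≱ 1≤j z≤n }) , ≤-trans (m≤m*n k a₁) j≤n)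
  ... | no a₁∤j | yes (divides q refl) =
    spread-gather-a₂ e bounded q (λ b∣q → a₁∤j (subst (a₁ ∣_) (*-comm a₂ q) (b∣t⇒a₁∣a₂t q b∣q)))
  ... | no a₁∤j | no a₂∤j = trans (vanishes (spread n (gather e) j ≟ 0)) (sym (divisible j a₁∤j a₂∤j))
    where
    vanishes : Dec (spread n (gather e) j ≡ 0) → spread n (gather e) j ≡ 0
    vanishes (yes ≡0) = ≡0
    vanishes (no ≢0) = ⊥-elim ([ a₁∤j , a₂∤j ] (spread-divisible n (gather e) j ≢0))

  gather-fits : ∀ e → (∀ j → e j ≢ 0 → j ≤ n) → ∀ k → InRange n k → Fits n k (gather e k)
  gather-fits e support k r =
    cong₂ (λ x y → a₁ * x + a₂ * y) (sym cx≡) (sym cy≡) , fits-x , fits-y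
    where
    X = e (k * a₁)
    Y = digit (ν k) (e (core k * a₂))
    cx≡ : cx (gather e k) ≡ X
    cx≡ = cx-canonical X Y (digit<b (ν k) _)
    cy≡ : cy (gather e k) ≡ Y
    cy≡ = cy-canonical X Y (digit<b (ν k) _)
    fits-x : cx (gather e k) ≡ 0 ⊎ k * a₁ ≤ n
    fits-x with X ≟ 0
    ... | yes X≡0 = inj₁ (trans cx≡ X≡0)
    ... | no X≢0 = inj₂ (support _ X≢0)
    fits-y : cy (gather e k) ≡ 0 ⊎ core k * a₂ ≤ n
    fits-y with Y ≟ 0
    ... | yes Y≡0 = inj₁ (trans cy≡ Y≡0)
    ... | no Y≢0 = inj₂ (support _ (λ E≡0 → Y≢0 (trans (cong (digit (ν k)) E≡0) (digit-zero (ν k)))))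

  mults-fit : ∀ (π : PartitionWith n (CondII a₁ a₂)) → CondII a₁ a₂ (PartitionWith.parts π) →
              ∀ k → InRange n k → Fits n k (mult k (PartitionWith.parts π))
  mults-fit π cond k _ = fits-of-InS n k _ (mults-InS _ cond k) (mults-bounded π k)

  mults-divisible : ∀ xs → CondIII a₁ a₂ xs → ∀ j → ¬ (a₁ ∣ j) → ¬ (a₂ ∣ j) → mult j xs ≡ 0
  mults-divisible xs cond j a₁∤j a₂∤j =
    mult-∉ xs (All-map (λ a∣x j≡x → [ a₁∤j , a₂∤j ] (subst (λ x → a₁ ∣ x ⊎ a₂ ∣ x) (sym j≡x) a∣x)) cond)

  spreadPartition : PartitionWith n (CondII a₁ a₂) → PartitionWith n (CondIII a₁ a₂)
  spreadPartition π@(partition xs _ _ _ cond) =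
    expandPartition (spread n (mults xs))
      (trans (weight-spread n n (mults xs) (mults-fit π cond)) (weight-mults xs (sorted π) (inRange π) (total′ π)))
      (expand-all (spread n (mults xs)) n (λ j _ → spread-divisible n (mults xs) j))

  gatherPartition : PartitionWith n (CondIII a₁ a₂) → PartitionWith n (CondII a₁ a₂)
  gatherPartition π@(partition xs _ _ _ cond) =
    expandPartition (gather e) (size cond)
      (expand-CondII (gather e) n (λ k _ → gather-InS e k))
    where
    e = mults xs
    size : CondIII a₁ a₂ xs → weight (gather e) n ≡ n
    size cond = begin
      weight (gather e) n               ≡⟨ sym (weight-spread n n (gather e) (gather-fits e (mults-support π))) ⟩
      weight (spread n (gather e)) n    ≡⟨ weight-cong n (spread-gather e (mults-divisible xs cond) (mults-bounded π)) ⟩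
      weight e n                        ≡⟨ weight-mults xs (sorted π) (inRange π) (total′ π) ⟩
      n                                 ∎
      where open ≡-Reasoning

  spread∘gather : ∀ π → spreadPartition (gatherPartition π) ≡ π
  spread∘gather π@(partition xs _ _ _ cond) = partition-ext _ π λ j → begin
    mult j (expand (spread n (mults (expand (gather e) n))) n)  ≡⟨ expand-mult _ n j ⟩
    restrict n (spread n (mults (expand (gather e) n))) j       ≡⟨ restrict-cong n j (λ _ → spread-cong n j expanded) ⟩
    restrict n (spread n (gather e)) j
      ≡⟨ restrict-cong n j (spread-gather e divisible (mults-bounded π) j) ⟩
    restrict n e j                                              ≡⟨ mults-restrict xs (inRange π) j ⟩
    mult j xs                                                   ∎
    where
    open ≡-Reasoning
    e = mults xs
    expanded : ∀ k → InRange n k → mult k (expand (gather e) n) ≡ gather e k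
    expanded k r = trans (expand-mult (gather e) n k) (restrict-in _ k r)
    divisible : ∀ j → ¬ (a₁ ∣ j) → ¬ (a₂ ∣ j) → e j ≡ 0
    divisible j a₁∤j a₂∤j = recompute (e j ≟ 0) (mults-divisible xs cond j a₁∤j a₂∤j)

  gather∘spread : ∀ π → gatherPartition (spreadPartition π) ≡ π
  gather∘spread π@(partition xs _ _ _ cond) = partition-ext _ π λ k → begin
    mult k (expand (gather (mults (expand (spread n m) n))) n)  ≡⟨ expand-mult _ n k ⟩
    restrict n (gather (mults (expand (spread n m) n))) k
      ≡⟨ restrict-cong n k (λ _ → gather-cong k (expand-mult (spread n m) n)) ⟩
    restrict n (gather (restrict n (spread n m))) k             ≡⟨ restrict-cong n k (gather-spread m fits k) ⟩
    restrict n m k                                              ≡⟨ mults-restrict xs (inRange π) k ⟩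
    mult k xs                                                   ∎
    where
    open ≡-Reasoning
    m = mults xs
    fits : ∀ k → InRange n k → Fits n k (m k)
    fits k r = recompute (fits? n k (m k)) (mults-fit π cond k r)

  glaisher : PartitionWith n (CondII a₁ a₂) ↔ PartitionWith n (CondIII a₁ a₂)
  glaisher = mk↔ₛ′ spreadPartition gatherPartition spread∘gather gather∘spread

module Reduced (a₁ a₂ : ℕ) .{{_ : NonZero a₁}} where

  g : ℕ
  g = gcd a₁ a₂

  instance
    g-nonZero : NonZero g
    g-nonZero = ≢-nonZero (gcd[m,n]≢0 a₁ a₂ (inj₁ (≢-nonZero⁻¹ a₁)))

  b c : ℕ
  b = a₁ / g
  c = a₂ / g

  a₁≡bg : a₁ ≡ b * g
  a₁≡bg = sym (m/n*n≡m (gcd[m,n]∣m a₁ a₂))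

  a₂≡cg : a₂ ≡ c * g
  a₂≡cg = sym (m/n*n≡m (gcd[m,n]∣n a₁ a₂))

  instance
    b-nonZero : NonZero b
    b-nonZero = ≢-nonZero (λ b≡0 → ≢-nonZero⁻¹ a₁ (trans a₁≡bg (cong (_* g) b≡0)))

  -- cancel g, then use that b and c are coprime
  a₁∣a₂t⇒b∣t : ∀ t → a₁ ∣ a₂ * t → b ∣ t
  a₁∣a₂t⇒b∣t t a₁∣a₂t = coprime-divisor (coprime-/gcd a₁ a₂) (*-cancelˡ-∣ g gb∣gct)
    where
    gb∣gct : g * b ∣ g * (c * t)
    gb∣gct = subst₂ _∣_ (trans a₁≡bg (*-comm b g)) (trans (cong (_* t) a₂≡cg) (regroup c g t)) a₁∣a₂t
      where
      regroup : ∀ c g t → c * g * t ≡ g * (c * t)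
      regroup = solve-∀

  b∣t⇒a₁∣a₂t : ∀ t → b ∣ t → a₁ ∣ a₂ * t
  b∣t⇒a₁∣a₂t .(r * b) (divides r refl) = divides (r * c) (begin
    a₂ * (r * b)       ≡⟨ cong (_* (r * b)) a₂≡cg ⟩
    c * g * (r * b)    ≡⟨ regroup c g r b ⟩
    r * c * (b * g)    ≡⟨ cong (r * c *_) (sym a₁≡bg) ⟩
    r * c * a₁         ∎)
    where
    open ≡-Reasoning
    regroup : ∀ c g r b → c * g * (r * b) ≡ r * c * (b * g)
    regroup = solve-∀

theorem1 : (n a₁ a₂ : ℕ) → 1 ≤ n → 1 ≤ a₁ → 1 ≤ a₂ →
    (PartitionWith n (CondI a₁ a₂) ↔ PartitionWith n (CondII a₁ a₂))
      × (PartitionWith n (CondII a₁ a₂) ↔ PartitionWith n (CondIII a₁ a₂))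
theorem1 n a₁ a₂ _ 1≤a₁ 1≤a₂ =
  Conjugation.conjugation n a₁ a₂ , Glaisher.glaisher n a₁ a₂ b a₁∣a₂t⇒b∣t b∣t⇒a₁∣a₂t
  where
  instance
    a₁-nonZero : NonZero a₁
    a₁-nonZero = >-nonZero 1≤a₁
    a₂-nonZero : NonZero a₂
    a₂-nonZero = >-nonZero 1≤a₂
  open Reduced a₁ a₂
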